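{- Let $T$ be a perfect $k$-ary tree of depth $d$, some of whose leaves are colored red. For a node $x$ let $T_x$ be the subtree rooted at $x$ and $\mu(T_x)$ the fraction of leaves of $T_x$ that are red. Then $$\mathbf{E}_{u,t\sim\mathcal{P}}\Big[\frac1k\sum_{y\in\mathrm{child}(u(t))}\big|\mu(T_y)-\mu(T_{u(t)})\big|\Big]\le\mu(T)\sqrt{\frac{2\log_2(1/\mu(T))}{d}},$$ where the right-hand side is interpreted as $0$ when $\mu(T)=0$.
   Context: $\mathrm{child}(x)$ is the set of $k$ children of an internal node $x$. The distribution $\mathcal{P}$: pick a uniformly random leaf $u$ of $T$, let $u(0),\dots,u(d)=u$ be the root-to-$u$ path, pick $t$ uniformly in $\{0,\dots,d-1\}$ independently, and output $u(t)$. -}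

module Defs where

open import Data.Nat as ℕ using (ℕ; zero; suc; NonZero)
open import Data.Nat.Properties using (m^n≢0)
open import Data.Integer using (+_)
open import Data.Fin using (Fin; zero; suc)
open import Data.Vec using (Vec; []; _∷_)
open import Data.Bool using (Bool; true; false)
open import Data.Product using (Σ; _,_)
open import Data.Rational using (ℚ; 0ℚ; 1ℚ; _+_; _*_; _-_; _/_; ∣_∣)

-- A perfect k-ary tree of depth d whose leaves are coloured
-- (true = red, false = not red).  Depth 0: a single leaf.
Tree : ℕ → ℕ → Set
Tree k zero    = Bool
Tree k (suc d) = Fin k → Tree k d

Leaf : ℕ → ℕ → Set
Leaf k d = Vec (Fin k) d

Σfin : (n : ℕ) → (Fin n → ℚ) → ℚ
Σfin zero    f = 0ℚ
Σfin (suc n) f = f zero + Σfin n (λ i → f (suc i))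

Σℕfin : (n : ℕ) → (Fin n → ℕ) → ℕ
Σℕfin zero    f = 0
Σℕfin (suc n) f = f zero ℕ.+ Σℕfin n (λ i → f (suc i))

ΣLeaves : (k d : ℕ) → (Leaf k d → ℚ) → ℚ
ΣLeaves k zero    g = g []
ΣLeaves k (suc d) g = Σfin k (λ i → ΣLeaves k d (λ u → g (i ∷ u)))

reds : (k d : ℕ) → Tree k d → ℕ
reds k zero    true  = 1
reds k zero    false = 0
reds k (suc d) T     = Σℕfin k (λ i → reds k d (T i))

μ : (k : ℕ) .{{_ : NonZero k}} → (d : ℕ) → Tree k d → ℚ
μ k d T = (+ reds k d T) / (k ℕ.^ d)
  where instance _ = m^n≢0 k d

-- An internal node (depth ≥ 1 subtree), packaged with its depth.
Internal : ℕ → Set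
Internal k = Σ ℕ (λ m → Tree k (suc m))

-- node u(t) (as the subtree T_{u(t)}) on the root-to-u path, t ∈ {0,…,d-1}.
nodeOnPath : (k d : ℕ) → Tree k d → Leaf k d → Fin d → Internal k
nodeOnPath k (suc d) T (i ∷ u) zero    = d , T
nodeOnPath k (suc d) T (i ∷ u) (suc t) = nodeOnPath k d (T i) u t

childDev : (k : ℕ) .{{_ : NonZero k}} → Internal k → ℚ
childDev k (m , S) =
  ((+ 1) / k) * Σfin k (λ i → ∣ μ k m (S i) - μ k (suc m) S ∣)

-- E_{u,t ∼ P}[ childDev(u(t)) ]: u uniform leaf, t uniform in {0,…,d-1}.
expectation : (k : ℕ) .{{_ : NonZero k}} → (d : ℕ) .{{_ : NonZero d}}
            → Tree k d → ℚ
expectation k d T =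
  ((+ 1) / (k ℕ.^ d)) *
    ΣLeaves k d (λ u → ((+ 1) / d) * Σfin d (λ t → childDev k (nodeOnPath k d T u t)))
  where instance _ = m^n≢0 k d

_^ℚ_ : ℚ → ℕ → ℚ
q ^ℚ zero  = 1ℚ
q ^ℚ suc n = q * (q ^ℚ n)

module Submission where

-- Let r_x be the number of red leaves below a node x, r that of the root, and A = Σ_x A_x over
-- the internal nodes, where A_x = Σ_{y ∈ child(x)} |k r_y − r_x|; then E = A / (k^(d+1) d).
-- Pinsker's inequality for the distribution of the red leaves among the children of x gives
-- A_x² ≤ 2 k² r_x Φ_x with Φ_x = log₂ (k^(r_x) Π_y r_y^(r_y) / r_x^(r_x)). In the linearised form
-- 2 p q A_x ≤ 2 k q² Φ_x + k r_x p² these bounds add up over the tree: the Φ_x telescope to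
-- r log₂ (k^d / r) and the r_x add up to d r. Taking p = A and q = k r d then gives
-- A² ≤ 2 k² r² d log₂ (k^d / r), which is the claim. All logarithms are exponentiated, so every
-- inequality is one between natural numbers. Pinsker's inequality (in bits, with the weaker
-- constant 2) is reduced to two points by the log-sum inequality, and the two-point case is a
-- telescoping sum of one-unit moves, each bounded by weighted AM–GM.

module PowerInequalities where

  open import Data.Nat
  open import Data.Nat.Properties
  open import Data.Nat.Tactic.RingSolver using (solve-∀)
  open import Data.Product using (_,_)
  open import Data.Sum using (inj₁; inj₂)
  open import Relation.Binary.PropositionalEquality
  open import Algebra.Properties.CommutativeSemigroup *-commutativeSemigroup
    using (interchange)
  open ≤-Reasoning

  ^-distribʳ-* : ∀ m n o → (m * n) ^ o ≡ m ^ o * n ^ o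
  ^-distribʳ-* m n zero    = refl
  ^-distribʳ-* m n (suc o) = trans (cong (m * n *_) (^-distribʳ-* m n o)) (interchange m n (m ^ o) (n ^ o))

  m≤m*m : ∀ m → m ≤ m * m
  m≤m*m zero    = z≤n
  m≤m*m (suc m) = m≤m*n (suc m) (suc m)

  ≤-nonZero : ∀ {m n} .{{_ : NonZero m}} → m ≤ n → NonZero n
  ≤-nonZero {m} m≤n = >-nonZero (<-≤-trans (>-nonZero⁻¹ m) m≤n)

  ^-*-comm : ∀ m n o → (m ^ n) ^ o ≡ (m ^ o) ^ n
  ^-*-comm m n o = trans (^-*-assoc m n o) (trans (cong (m ^_) (*-comm n o)) (sym (^-*-assoc m o n)))

  ^-cancelʳ-≤ : ∀ {m n} o .{{_ : NonZero o}} → m ^ o ≤ n ^ o → m ≤ n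
  ^-cancelʳ-≤ o le = ≮⇒≥ λ n<m → <⇒≱ (^-monoˡ-< o n<m) le

  n^n≢0 : ∀ n → NonZero (n ^ n)
  n^n≢0 zero    = _
  n^n≢0 (suc n) = m^n≢0 (suc n) (suc n)

  2*m*n≤m*m+n*n : ∀ m n → 2 * m * n ≤ m * m + n * n
  2*m*n≤m*m+n*n m n with ≤-total m n
  ... | inj₁ m≤n with m≤n⇒∃[o]m+o≡n m≤n
  ...   | o , refl = subst (2 * m * (m + o) ≤_) (gap m o) (m≤m+n _ (o * o))
    where
    gap : ∀ m o → 2 * m * (m + o) + o * o ≡ m * m + (m + o) * (m + o)
    gap = solve-∀
  2*m*n≤m*m+n*n m n | inj₂ n≤m with m≤n⇒∃[o]m+o≡n n≤m
  ...   | o , refl = subst (2 * (n + o) * n ≤_) (gap n o) (m≤m+n _ (o * o))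
    where
    gap : ∀ n o → 2 * (n + o) * n + o * o ≡ (n + o) * (n + o) + n * n
    gap = solve-∀

  4*m*n≤[m+n]*[m+n] : ∀ m n → 4 * (m * n) ≤ (m + n) * (m + n)
  4*m*n≤[m+n]*[m+n] m n = subst₂ _≤_ (e₁ m n) (e₂ m n) (+-monoˡ-≤ (2 * m * n) (2*m*n≤m*m+n*n m n))
    where
    e₁ : ∀ m n → 2 * m * n + 2 * m * n ≡ 4 * (m * n)
    e₁ = solve-∀
    e₂ : ∀ m n → m * m + n * n + 2 * m * n ≡ (m + n) * (m + n)
    e₂ = solve-∀

  young : ∀ m P Q → suc m * (Q ^ m * P) ≤ P ^ suc m + m * Q ^ suc m
  young zero    P Q = ≤-reflexive (e₁ P)
    where
    e₁ : ∀ P → 1 * (1 * P) ≡ P * 1 + 0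
    e₁ = solve-∀
  young (suc m) P Q = +-cancelʳ-≤ _ _ _ (begin
      suc (suc m) * (Q * X * P) + (m * (Q * X) * P + suc m * X * (P * P))
        ≡⟨ lhs m X P Q ⟩
      suc m * (X * P) * P + suc m * X * (2 * P * Q)
        ≤⟨ +-mono-≤ (*-monoˡ-≤ P (young m P Q)) (*-monoʳ-≤ (suc m * X) (2*m*n≤m*m+n*n P Q)) ⟩
      (P ^ suc m + m * (Q * X)) * P + suc m * X * (P * P + Q * Q)
        ≡⟨ rhs m X P Q (P ^ suc m) ⟩
      (P * P ^ suc m + suc m * (Q * (Q * X))) + (m * (Q * X) * P + suc m * X * (P * P)) ∎)
    where
    X = Q ^ m
    lhs : ∀ m X P Q → suc (suc m) * (Q * X * P) + (m * (Q * X) * P + suc m * X * (P * P))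
                    ≡ suc m * (X * P) * P + suc m * X * (2 * P * Q)
    lhs = solve-∀
    rhs : ∀ m X P Q Y → (Y + m * (Q * X)) * P + suc m * X * (P * P + Q * Q)
                      ≡ (P * Y + suc m * (Q * (Q * X))) + (m * (Q * X) * P + suc m * X * (P * P))
    rhs = solve-∀

  amgm-step : ∀ n X y → suc n ^ suc n * X ^ n * y ≤ n ^ n * (X + y) ^ suc n
  amgm-step zero X y = subst₂ _≤_ (sym (e₁ y)) (sym (e₂ X y)) (m≤n+m y X)
    where
    e₁ : ∀ y → 1 * 1 * y ≡ y
    e₁ = solve-∀
    e₂ : ∀ X y → 1 * ((X + y) * 1) ≡ X + y
    e₂ = solve-∀
  amgm-step n@(suc _) X y = *-cancelˡ-≤ n (begin
      n * (suc n ^ suc n * X ^ n * y)  ≡⟨ trans (e₁ n (suc n ^ n) (X ^ n) y)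
                                            (cong (λ z → n * (suc n * z * y)) (sym (^-distribʳ-* (suc n) X n))) ⟩
      n * (suc n * Q ^ n * y)          ≤⟨ +-cancelˡ-≤ (n * Q ^ suc n) _ _ (begin
          n * Q ^ suc n + n * (suc n * Q ^ n * y)  ≡⟨ e₂ n X y (Q ^ n) ⟩
          suc n * (Q ^ n * P)                      ≤⟨ young n P Q ⟩
          P ^ suc n + n * Q ^ suc n                ≡⟨ +-comm (P ^ suc n) _ ⟩
          n * Q ^ suc n + P ^ suc n                ∎) ⟩
      P ^ suc n                        ≡⟨ ^-distribʳ-* n (X + y) (suc n) ⟩
      n * n ^ n * (X + y) ^ suc n      ≡⟨ *-assoc n (n ^ n) ((X + y) ^ suc n) ⟩
      n * (n ^ n * (X + y) ^ suc n)    ∎)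
    where
    P = n * (X + y)
    Q = suc n * X
    e₁ : ∀ n a b y → n * (suc n * a * b * y) ≡ n * (suc n * (a * b) * y)
    e₁ = solve-∀
    e₂ : ∀ n X y q → n * (suc n * X * q) + n * (suc n * q * y) ≡ suc n * (q * (n * (X + y)))
    e₂ = solve-∀

  amgm₂ : ∀ R S v w → v ^ R * w ^ S * (R + S) ^ (R + S) ≤ (R * v + S * w) ^ (R + S)
  amgm₂ R zero v w rewrite +-identityʳ R | +-identityʳ (R * v) = ≤-reflexive (begin-equality
      v ^ R * 1 * R ^ R  ≡⟨ cong (_* R ^ R) (*-identityʳ (v ^ R)) ⟩
      v ^ R * R ^ R      ≡⟨ *-comm (v ^ R) (R ^ R) ⟩
      R ^ R * v ^ R      ≡⟨ ^-distribʳ-* R v R ⟨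
      (R * v) ^ R        ∎)
  amgm₂ R (suc S) v w rewrite +-suc R S = *-cancelˡ-≤ (n ^ n) {{n^n≢0 n}} (begin
      n ^ n * (v ^ R * w ^ suc S * suc n ^ suc n)  ≡⟨ e₁ (n ^ n) (v ^ R) (w ^ S) w (suc n ^ suc n) ⟩
      v ^ R * w ^ S * n ^ n * (w * suc n ^ suc n)  ≤⟨ *-monoˡ-≤ _ (amgm₂ R S v w) ⟩
      X ^ n * (w * suc n ^ suc n)                  ≡⟨ e₂ (X ^ n) w (suc n ^ suc n) ⟩
      suc n ^ suc n * X ^ n * w                    ≤⟨ amgm-step n X w ⟩
      n ^ n * (X + w) ^ suc n                      ≡⟨ cong (λ z → n ^ n * z ^ suc n) (e₃ R v S w) ⟩
      n ^ n * (R * v + suc S * w) ^ suc n          ∎)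
    where
    n = R + S
    X = R * v + S * w
    e₁ : ∀ a b c d f → a * (b * (d * c) * f) ≡ b * c * a * (d * f)
    e₁ = solve-∀
    e₂ : ∀ a b c → a * (b * c) ≡ c * a * b
    e₂ = solve-∀
    e₃ : ∀ R v S w → R * v + S * w + w ≡ R * v + (w + S * w)
    e₃ = solve-∀

  amgm-in-exponent : ∀ x y A c q → x * 2 ^ (A * A) ≤ y →
                     x ^ (q * q) * 2 ^ (2 * (q * A) * c) ≤ y ^ (q * q) * 2 ^ (c * c)
  amgm-in-exponent x y A c q x2^A²≤y = begin
    x ^ (q * q) * 2 ^ (2 * (q * A) * c)
      ≤⟨ *-monoʳ-≤ (x ^ (q * q)) (^-monoʳ-≤ 2 (2*m*n≤m*m+n*n (q * A) c)) ⟩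
    x ^ (q * q) * 2 ^ (q * A * (q * A) + c * c)
      ≡⟨ cong (x ^ (q * q) *_) (trans (cong (λ t → 2 ^ (t + c * c)) (e₁ q A)) (^-distribˡ-+-* 2 (A * A * (q * q)) (c * c))) ⟩
    x ^ (q * q) * (2 ^ (A * A * (q * q)) * 2 ^ (c * c))
      ≡⟨ *-assoc (x ^ (q * q)) (2 ^ (A * A * (q * q))) (2 ^ (c * c)) ⟨
    x ^ (q * q) * 2 ^ (A * A * (q * q)) * 2 ^ (c * c)
      ≡⟨ cong (λ t → x ^ (q * q) * t * 2 ^ (c * c)) (^-*-assoc 2 (A * A) (q * q)) ⟨
    x ^ (q * q) * (2 ^ (A * A)) ^ (q * q) * 2 ^ (c * c)
      ≡⟨ cong (_* 2 ^ (c * c)) (^-distribʳ-* x (2 ^ (A * A)) (q * q)) ⟨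
    (x * 2 ^ (A * A)) ^ (q * q) * 2 ^ (c * c)
      ≤⟨ *-monoˡ-≤ (2 ^ (c * c)) (^-monoˡ-≤ (q * q) x2^A²≤y) ⟩
    y ^ (q * q) * 2 ^ (c * c) ∎
    where
    e₁ : ∀ q A → q * A * (q * A) ≡ A * A * (q * q)
    e₁ = solve-∀

module FinBigOperators where

  open import Data.Nat
  open import Data.Nat.Properties
  open import Data.Fin using (Fin; zero; suc)
  open import Function using (_∘_)
  open import Relation.Binary.PropositionalEquality
  open import Algebra.Properties.CommutativeSemigroup +-commutativeSemigroup
    renaming (interchange to +-interchange)
  open import Algebra.Properties.CommutativeSemigroup *-commutativeSemigroup
    renaming (interchange to *-interchange)
  open import Defs using (Σℕfin) public
  open PowerInequalities using (^-distribʳ-*)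

  Πℕfin : (n : ℕ) → (Fin n → ℕ) → ℕ
  Πℕfin zero    f = 1
  Πℕfin (suc n) f = f zero * Πℕfin n (f ∘ suc)

  Σℕfin-cong : ∀ n {f g : Fin n → ℕ} → (∀ i → f i ≡ g i) → Σℕfin n f ≡ Σℕfin n g
  Σℕfin-cong zero    eq = refl
  Σℕfin-cong (suc n) eq = cong₂ _+_ (eq zero) (Σℕfin-cong n (eq ∘ suc))

  Σℕfin-+ : ∀ n (f g : Fin n → ℕ) → Σℕfin n (λ i → f i + g i) ≡ Σℕfin n f + Σℕfin n g
  Σℕfin-+ zero    f g = refl
  Σℕfin-+ (suc n) f g =
    trans (cong (f zero + g zero +_) (Σℕfin-+ n (f ∘ suc) (g ∘ suc))) (+-interchange (f zero) (g zero) _ _)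

  Σℕfin-*ˡ : ∀ n c (f : Fin n → ℕ) → Σℕfin n (λ i → c * f i) ≡ c * Σℕfin n f
  Σℕfin-*ˡ zero    c f = sym (*-zeroʳ c)
  Σℕfin-*ˡ (suc n) c f =
    trans (cong (c * f zero +_) (Σℕfin-*ˡ n c (f ∘ suc))) (sym (*-distribˡ-+ c (f zero) _))

  Σℕfin≡0⇒≡0 : ∀ n (f : Fin n → ℕ) → Σℕfin n f ≡ 0 → ∀ i → f i ≡ 0
  Σℕfin≡0⇒≡0 (suc n) f eq zero    = m+n≡0⇒m≡0 (f zero) eq
  Σℕfin≡0⇒≡0 (suc n) f eq (suc i) = Σℕfin≡0⇒≡0 n (f ∘ suc) (m+n≡0⇒n≡0 (f zero) eq) i

  Σℕfin-const : ∀ n c → Σℕfin n (λ _ → c) ≡ n * c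
  Σℕfin-const zero    c = refl
  Σℕfin-const (suc n) c = cong (c +_) (Σℕfin-const n c)

  Πℕfin-cong : ∀ n {f g : Fin n → ℕ} → (∀ i → f i ≡ g i) → Πℕfin n f ≡ Πℕfin n g
  Πℕfin-cong zero    eq = refl
  Πℕfin-cong (suc n) eq = cong₂ _*_ (eq zero) (Πℕfin-cong n (eq ∘ suc))

  Πℕfin-* : ∀ n (f g : Fin n → ℕ) → Πℕfin n (λ i → f i * g i) ≡ Πℕfin n f * Πℕfin n g
  Πℕfin-* zero    f g = refl
  Πℕfin-* (suc n) f g =
    trans (cong (f zero * g zero *_) (Πℕfin-* n (f ∘ suc) (g ∘ suc))) (*-interchange (f zero) (g zero) _ _)

  Πℕfin-const : ∀ n c → Πℕfin n (λ _ → c) ≡ c ^ n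
  Πℕfin-const zero    c = refl
  Πℕfin-const (suc n) c = cong (c *_) (Πℕfin-const n c)

  Πℕfin-^ : ∀ n m (f : Fin n → ℕ) → Πℕfin n (λ i → f i ^ m) ≡ Πℕfin n f ^ m
  Πℕfin-^ zero    m f = sym (^-zeroˡ m)
  Πℕfin-^ (suc n) m f = trans (cong (f zero ^ m *_) (Πℕfin-^ n m (f ∘ suc))) (sym (^-distribʳ-* (f zero) _ m))

  Πℕfin-^-Σℕfin : ∀ n m (e : Fin n → ℕ) → Πℕfin n (λ i → m ^ e i) ≡ m ^ Σℕfin n e
  Πℕfin-^-Σℕfin zero    m e = refl
  Πℕfin-^-Σℕfin (suc n) m e =
    trans (cong (m ^ e zero *_) (Πℕfin-^-Σℕfin n m (e ∘ suc))) (sym (^-distribˡ-+-* m (e zero) _))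

  Πℕfin-mono-≤ : ∀ n {f g : Fin n → ℕ} → (∀ i → f i ≤ g i) → Πℕfin n f ≤ Πℕfin n g
  Πℕfin-mono-≤ zero    le = ≤-refl
  Πℕfin-mono-≤ (suc n) le = *-mono-≤ (le zero) (Πℕfin-mono-≤ n (le ∘ suc))

  Πℕfin≢0 : ∀ n (f : Fin n → ℕ) → (∀ i → NonZero (f i)) → NonZero (Πℕfin n f)
  Πℕfin≢0 zero    f nz = _
  Πℕfin≢0 (suc n) f nz = m*n≢0 _ _ {{nz zero}} {{Πℕfin≢0 n (f ∘ suc) (nz ∘ suc)}}

module LogSumInequality where

  open import Data.Nat
  open import Data.Nat.Properties
  open import Data.Nat.Tactic.RingSolver using (solve-∀)
  open import Data.Fin using (Fin; zero; suc)
  open import Data.Sum using (inj₁; inj₂)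
  open import Function using (_∘_)
  open import Relation.Binary.PropositionalEquality
  open import Relation.Nullary using (yes; no; contradiction)
  open FinBigOperators
  open PowerInequalities
  open ≤-Reasoning

  logSum₂ : ∀ a b c d → (a + b) ^ (a + b) * (c ^ a * d ^ b) ≤ a ^ a * b ^ b * (c + d) ^ (a + b)
  logSum₂ zero b c d = begin
    b ^ b * (1 * d ^ b)      ≡⟨ cong (b ^ b *_) (*-identityˡ (d ^ b)) ⟩
    b ^ b * d ^ b            ≤⟨ *-monoʳ-≤ (b ^ b) (^-monoˡ-≤ b (m≤n+m d c)) ⟩
    b ^ b * (c + d) ^ b      ≡⟨ cong (_* (c + d) ^ b) (*-identityˡ (b ^ b)) ⟨
    1 * b ^ b * (c + d) ^ b  ∎
  logSum₂ a zero c d rewrite +-identityʳ a = begin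
    a ^ a * (c ^ a * 1)      ≡⟨ cong (a ^ a *_) (*-identityʳ (c ^ a)) ⟩
    a ^ a * c ^ a            ≤⟨ *-monoʳ-≤ (a ^ a) (^-monoˡ-≤ a (m≤m+n c d)) ⟩
    a ^ a * (c + d) ^ a      ≡⟨ cong (_* (c + d) ^ a) (*-identityʳ (a ^ a)) ⟨
    a ^ a * 1 * (c + d) ^ a  ∎
  logSum₂ a@(suc _) b@(suc _) c d = *-cancelˡ-≤ (a ^ b * b ^ a) {{m*n≢0 (a ^ b) (b ^ a) {{m^n≢0 a b}} {{m^n≢0 b a}}}} (begin
    a ^ b * b ^ a * ((a + b) ^ (a + b) * (c ^ a * d ^ b))
      ≡⟨ e₁ (a ^ b) (b ^ a) ((a + b) ^ (a + b)) (c ^ a) (d ^ b) ⟩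
    c ^ a * b ^ a * (d ^ b * a ^ b) * (a + b) ^ (a + b)
      ≡⟨ cong₂ (λ x y → x * y * (a + b) ^ (a + b)) (^-distribʳ-* c b a) (^-distribʳ-* d a b) ⟨
    (c * b) ^ a * (d * a) ^ b * (a + b) ^ (a + b)
      ≤⟨ amgm₂ a b (c * b) (d * a) ⟩
    (a * (c * b) + b * (d * a)) ^ (a + b)
      ≡⟨ cong (_^ (a + b)) (e₂ a b c d) ⟩
    (a * b * (c + d)) ^ (a + b)
      ≡⟨ ^-distribʳ-* (a * b) (c + d) (a + b) ⟩
    (a * b) ^ (a + b) * (c + d) ^ (a + b)
      ≡⟨ cong (_* (c + d) ^ (a + b)) (trans (^-distribʳ-* a b (a + b))
           (cong₂ _*_ (^-distribˡ-+-* a a b) (^-distribˡ-+-* b a b))) ⟩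
    a ^ a * a ^ b * (b ^ a * b ^ b) * (c + d) ^ (a + b)
      ≡⟨ e₃ (a ^ a) (a ^ b) (b ^ a) (b ^ b) ((c + d) ^ (a + b)) ⟩
    a ^ b * b ^ a * (a ^ a * b ^ b * (c + d) ^ (a + b))  ∎)
    where
    e₁ : ∀ x y z u v → x * y * (z * (u * v)) ≡ u * y * (v * x) * z
    e₁ = solve-∀
    e₂ : ∀ a b c d → a * (c * b) + b * (d * a) ≡ a * b * (c + d)
    e₂ = solve-∀
    e₃ : ∀ x y z u v → x * y * (z * u) * v ≡ y * z * (x * u * v)
    e₃ = solve-∀

  logSum-extend : ∀ a b c d P Q → b ^ b * P ≤ Q * d ^ b →
                  (a + b) ^ (a + b) * (c ^ a * P) ≤ a ^ a * Q * (c + d) ^ (a + b)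
  logSum-extend a b c d P Q ih with d ^ b ≟ 0
  ... | no d^b≢0 = *-cancelʳ-≤ _ _ (d ^ b) {{≢-nonZero d^b≢0}} (begin
    (a + b) ^ (a + b) * (c ^ a * P) * d ^ b  ≡⟨ e₁ ((a + b) ^ (a + b)) (c ^ a) P (d ^ b) ⟩
    (a + b) ^ (a + b) * (c ^ a * d ^ b) * P  ≤⟨ *-monoˡ-≤ P (logSum₂ a b c d) ⟩
    a ^ a * b ^ b * (c + d) ^ (a + b) * P    ≡⟨ e₂ (a ^ a) (b ^ b) ((c + d) ^ (a + b)) P ⟩
    a ^ a * (c + d) ^ (a + b) * (b ^ b * P)  ≤⟨ *-monoʳ-≤ (a ^ a * (c + d) ^ (a + b)) ih ⟩
    a ^ a * (c + d) ^ (a + b) * (Q * d ^ b)  ≡⟨ e₃ (a ^ a) ((c + d) ^ (a + b)) Q (d ^ b) ⟩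
    a ^ a * Q * (c + d) ^ (a + b) * d ^ b    ∎)
    where
    e₁ : ∀ x y z u → x * (y * z) * u ≡ x * (y * u) * z
    e₁ = solve-∀
    e₂ : ∀ x y z u → x * y * z * u ≡ x * z * (y * u)
    e₂ = solve-∀
    e₃ : ∀ x y z u → x * y * (z * u) ≡ x * z * y * u
    e₃ = solve-∀
  ... | yes d^b≡0 = ≤-trans (≤-reflexive lhs≡0) z≤n
    where
    P≡0 : P ≡ 0
    P≡0 with m*n≡0⇒m≡0∨n≡0 (b ^ b) (n≤0⇒n≡0 (subst (b ^ b * P ≤_) (trans (cong (Q *_) d^b≡0) (*-zeroʳ Q)) ih))
    ... | inj₁ b^b≡0 = contradiction b^b≡0 (≢-nonZero⁻¹ (b ^ b) {{n^n≢0 b}})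
    ... | inj₂ P≡0  = P≡0
    lhs≡0 : (a + b) ^ (a + b) * (c ^ a * P) ≡ 0
    lhs≡0 rewrite P≡0 | *-zeroʳ (c ^ a) = *-zeroʳ ((a + b) ^ (a + b))

  logSum : ∀ n (f c : Fin n → ℕ) →
           Σℕfin n f ^ Σℕfin n f * Πℕfin n (λ i → c i ^ f i)
           ≤ Πℕfin n (λ i → f i ^ f i) * Σℕfin n c ^ Σℕfin n f
  logSum zero    f c = ≤-refl
  logSum (suc n) f c = logSum-extend (f zero) _ (c zero) _ _ _ (logSum n (f ∘ suc) (c ∘ suc))

module BinaryPinsker where

  open import Data.Nat
  open import Data.Nat.Properties
  open import Data.Nat.Tactic.RingSolver using (solve-∀)
  open import Data.Product using (_,_)
  open import Data.Unit using (tt)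
  open import Relation.Binary.PropositionalEquality
  open import Relation.Nullary using (contradiction)
  open PowerInequalities
  open ≤-Reasoning

  -- With n = x + 1 + U and x + 1 + j = R n / r, the step from (x, U + 1) to (x + 1, U)
  -- increases R log (first) + S log (second) by at least r log (1 + 4j / n²).
  binary-step : ∀ R S x U j → R * U ≡ S * suc x + (R + S) * j →
    x ^ R * suc U ^ S * ((suc x + U) * (suc x + U) + 4 * j) ^ (R + S)
    ≤ suc x ^ R * U ^ S * ((suc x + U) * (suc x + U)) ^ (R + S)
  binary-step zero zero x U j eq = ≤-refl
  binary-step (suc R) zero x U j eq with *-cancelˡ-≡ U j (suc R) (trans eq (cong (_* j) (+-identityʳ (suc R))))
  ... | refl rewrite +-identityʳ R = begin
    x ^ suc R * 1 * (m + 4 * U) ^ suc R     ≡⟨ cong (_* (m + 4 * U) ^ suc R) (*-identityʳ (x ^ suc R)) ⟩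
    x ^ suc R * (m + 4 * U) ^ suc R         ≡⟨ ^-distribʳ-* x (m + 4 * U) (suc R) ⟨
    (x * (m + 4 * U)) ^ suc R               ≤⟨ ^-monoˡ-≤ (suc R) x[m+4U]≤[1+x]m ⟩
    (suc x * m) ^ suc R                     ≡⟨ ^-distribʳ-* (suc x) m (suc R) ⟩
    suc x ^ suc R * m ^ suc R               ≡⟨ cong (_* m ^ suc R) (*-identityʳ (suc x ^ suc R)) ⟨
    suc x ^ suc R * 1 * m ^ suc R           ∎
    where
    m = (suc x + U) * (suc x + U)
    4xU≤m : 4 * (x * U) ≤ m
    4xU≤m = ≤-trans (4*m*n≤[m+n]*[m+n] x U) (*-mono-≤ (n≤1+n (x + U)) (n≤1+n (x + U)))
    x[m+4U]≤[1+x]m : x * (m + 4 * U) ≤ suc x * m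
    x[m+4U]≤[1+x]m = subst₂ _≤_ (e₁ x m U) (+-comm (x * m) m) (+-monoʳ-≤ (x * m) 4xU≤m)
      where
      e₁ : ∀ x m U → x * m + 4 * (x * U) ≡ x * (m + 4 * U)
      e₁ = solve-∀
  binary-step R (suc S) x zero j eq = contradiction (trans (sym (*-zeroʳ R)) eq) λ ()
  binary-step R S@(suc _) x U@(suc _) j eq =
    *-cancelˡ-≤ (U ^ R * T ^ S) {{m*n≢0 (U ^ R) (T ^ S) {{m^n≢0 U R}} {{m^n≢0 T S}}}}
      (*-cancelˡ-≤ (r ^ r) {{n^n≢0 r}} (begin
        r ^ r * (U ^ R * T ^ S * (x ^ R * suc U ^ S * m′ ^ r))
          ≡⟨ e₁ (r ^ r) (U ^ R) (T ^ S) (x ^ R) (suc U ^ S) (m′ ^ r) ⟩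
        x ^ R * U ^ R * (suc U ^ S * T ^ S) * r ^ r * m′ ^ r
          ≡⟨ cong₂ (λ a b → a * b * r ^ r * m′ ^ r) (^-distribʳ-* x U R) (^-distribʳ-* (suc U) T S) ⟨
        (x * U) ^ R * (suc U * T) ^ S * r ^ r * m′ ^ r
          ≤⟨ *-monoˡ-≤ (m′ ^ r) (amgm₂ R S (x * U) (suc U * T)) ⟩
        Z ^ r * m′ ^ r
          ≡⟨ ^-distribʳ-* Z m′ r ⟨
        (Z * m′) ^ r
          ≤⟨ ^-monoˡ-≤ r Zm′≤rPm ⟩
        (r * (T * U) * m) ^ r
          ≡⟨ trans (^-distribʳ-* (r * (T * U)) m r) (cong (_* m ^ r) (trans (^-distribʳ-* r (T * U) r)
               (cong (r ^ r *_) (trans (^-distribʳ-* T U r) (cong₂ _*_ (^-distribˡ-+-* T R S) (^-distribˡ-+-* U R S)))))) ⟩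
        r ^ r * (T ^ R * T ^ S * (U ^ R * U ^ S)) * m ^ r
          ≡⟨ e₂ (r ^ r) (T ^ R) (T ^ S) (U ^ R) (U ^ S) (m ^ r) ⟩
        r ^ r * (U ^ R * T ^ S * (T ^ R * U ^ S * m ^ r)) ∎))
    where
    T = suc x
    r = R + S
    m = (T + U) * (T + U)
    m′ = m + 4 * j
    Z = R * (x * U) + S * (suc U * T)
    Z+rj≡rTU : Z + r * j ≡ r * (T * U)
    Z+rj≡rTU = begin-equality
      Z + r * j                                  ≡⟨ e₃ R S x U j ⟩
      R * x * U + S * T * U + (S * T + r * j)    ≡⟨ cong (R * x * U + S * T * U +_) eq ⟨
      R * x * U + S * T * U + R * U              ≡⟨ e₄ R S x U ⟩
      r * (T * U)                                ∎
      where
      e₃ : ∀ R S x U j → R * (x * U) + S * (suc U * suc x) + (R + S) * j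
                       ≡ R * x * U + S * suc x * U + (S * suc x + (R + S) * j)
      e₃ = solve-∀
      e₄ : ∀ R S x U → R * x * U + S * suc x * U + R * U ≡ (R + S) * (suc x * U)
      e₄ = solve-∀
    4Z≤rm : 4 * Z ≤ r * m
    4Z≤rm = begin
      4 * Z              ≤⟨ *-monoʳ-≤ 4 (subst (Z ≤_) Z+rj≡rTU (m≤m+n Z (r * j))) ⟩
      4 * (r * (T * U))  ≡⟨ e₅ r (T * U) ⟩
      r * (4 * (T * U))  ≤⟨ *-monoʳ-≤ r (4*m*n≤[m+n]*[m+n] T U) ⟩
      r * m              ∎
      where
      e₅ : ∀ r p → 4 * (r * p) ≡ r * (4 * p)
      e₅ = solve-∀
    Zm′≤rPm : Z * m′ ≤ r * (T * U) * m
    Zm′≤rPm = begin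
      Z * (m + 4 * j)        ≡⟨ e₆ Z m j ⟩
      Z * m + j * (4 * Z)    ≤⟨ +-monoʳ-≤ (Z * m) (*-monoʳ-≤ j 4Z≤rm) ⟩
      Z * m + j * (r * m)    ≡⟨ e₇ Z j r m ⟩
      (Z + r * j) * m        ≡⟨ cong (_* m) Z+rj≡rTU ⟩
      r * (T * U) * m        ∎
      where
      e₆ : ∀ Z m j → Z * (m + 4 * j) ≡ Z * m + j * (4 * Z)
      e₆ = solve-∀
      e₇ : ∀ Z j r m → Z * m + j * (r * m) ≡ (Z + r * j) * m
      e₇ = solve-∀
    e₁ : ∀ a b c d f g → a * (b * c * (d * f * g)) ≡ d * b * (f * c) * a * g
    e₁ = solve-∀
    e₂ : ∀ a b c d f g → a * (b * c * (d * f)) * g ≡ a * (d * c * (b * f * g))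
    e₂ = solve-∀

  2^24*5^50≤7^50 : 2 ^ 24 * 5 ^ 50 ≤ 7 ^ 50
  2^24*5^50≤7^50 = ≤ᵇ⇒≤ (2 ^ 24 * 5 ^ 50) (7 ^ 50) tt

  -- For 10j ≤ m, weighted AM–GM between 7 and 5 gives (1 + 4j/m)^m ≥ (7/5)^(10j),
  -- and (7/5)^50 ≥ 2^24.
  2^24j*m^5m≤[m+4j]^5m : ∀ j m → 10 * j ≤ m → 2 ^ (24 * j) * m ^ (5 * m) ≤ (m + 4 * j) ^ (5 * m)
  2^24j*m^5m≤[m+4j]^5m j m 10j≤m with m≤n⇒∃[o]m+o≡n 10j≤m
  ... | u , refl = *-cancelˡ-≤ (5 ^ (50 * j)) {{m^n≢0 5 (50 * j)}} (begin
      5 ^ (50 * j) * (2 ^ (24 * j) * m ^ (5 * m))  ≡⟨ e₁ (5 ^ (50 * j)) (2 ^ (24 * j)) (m ^ (5 * m)) ⟩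
      2 ^ (24 * j) * 5 ^ (50 * j) * m ^ (5 * m)    ≡⟨ cong (_* m ^ (5 * m)) (power-of-product 2 24 5 50 j) ⟨
      (2 ^ 24 * 5 ^ 50) ^ j * m ^ (5 * m)          ≤⟨ *-monoˡ-≤ (m ^ (5 * m)) (^-monoˡ-≤ j 2^24*5^50≤7^50) ⟩
      (7 ^ 50) ^ j * m ^ (5 * m)                   ≡⟨ cong₂ _*_ (trans (^-*-assoc 7 50 j) (cong (7 ^_) (e₄ j))) (cong (m ^_) (*-comm 5 m)) ⟩
      7 ^ (10 * j * 5) * m ^ (m * 5)               ≡⟨ power-of-product 7 (10 * j) m m 5 ⟨
      (7 ^ (10 * j) * m ^ m) ^ 5                   ≤⟨ ^-monoˡ-≤ 5 7^10j*m^m≤5^10j*[m+4j]^m ⟩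
      (5 ^ (10 * j) * (m + 4 * j) ^ m) ^ 5         ≡⟨ power-of-product 5 (10 * j) (m + 4 * j) m 5 ⟩
      5 ^ (10 * j * 5) * (m + 4 * j) ^ (m * 5)     ≡⟨ cong₂ (λ a b → 5 ^ a * (m + 4 * j) ^ b) (sym (e₄ j)) (*-comm m 5) ⟩
      5 ^ (50 * j) * (m + 4 * j) ^ (5 * m)         ∎)
    where
    power-of-product : ∀ x a y b c → (x ^ a * y ^ b) ^ c ≡ x ^ (a * c) * y ^ (b * c)
    power-of-product x a y b c = trans (^-distribʳ-* (x ^ a) (y ^ b) c) (cong₂ _*_ (^-*-assoc x a c) (^-*-assoc y b c))
    e₁ : ∀ a b c → a * (b * c) ≡ b * a * c
    e₁ = solve-∀
    e₄ : ∀ j → 50 * j ≡ 10 * j * 5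
    e₄ = solve-∀
    7^10j*m^m≤5^10j*[m+4j]^m : 7 ^ (10 * j) * m ^ m ≤ 5 ^ (10 * j) * (m + 4 * j) ^ m
    7^10j*m^m≤5^10j*[m+4j]^m = *-cancelˡ-≤ (5 ^ u) {{m^n≢0 5 u}} (begin
      5 ^ u * (7 ^ (10 * j) * m ^ m)            ≡⟨ e₂ (5 ^ u) (7 ^ (10 * j)) (m ^ m) ⟩
      7 ^ (10 * j) * 5 ^ u * m ^ m              ≤⟨ amgm₂ (10 * j) u 7 5 ⟩
      (10 * j * 7 + u * 5) ^ m                  ≡⟨ cong (_^ m) (e₃ j u) ⟩
      (5 * (m + 4 * j)) ^ m                     ≡⟨ ^-distribʳ-* 5 (m + 4 * j) m ⟩
      5 ^ m * (m + 4 * j) ^ m                   ≡⟨ cong (_* (m + 4 * j) ^ m) (^-distribˡ-+-* 5 (10 * j) u) ⟩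
      5 ^ (10 * j) * 5 ^ u * (m + 4 * j) ^ m    ≡⟨ e₂′ (5 ^ (10 * j)) (5 ^ u) ((m + 4 * j) ^ m) ⟩
      5 ^ u * (5 ^ (10 * j) * (m + 4 * j) ^ m)  ∎)
      where
      e₂ : ∀ a b c → a * (b * c) ≡ b * a * c
      e₂ = solve-∀
      e₂′ : ∀ a b c → a * b * c ≡ b * (a * c)
      e₂′ = solve-∀
      e₃ : ∀ j u → 10 * j * 7 + u * 5 ≡ 5 * (10 * j + u + 4 * j)
      e₃ = solve-∀

  binary-step₂ : ∀ R S x U j n → suc x + U ≡ n → R * U ≡ S * suc x + (R + S) * j → 10 * j ≤ n * n →
    (x ^ R * suc U ^ S) ^ (5 * (n * n)) * 2 ^ (24 * j * (R + S)) ≤ (suc x ^ R * U ^ S) ^ (5 * (n * n))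
  binary-step₂ R S x U j n refl balance 10j≤m =
    *-cancelʳ-≤ _ _ ((m ^ k) ^ r) {{m^n≢0 (m ^ k) r {{m^n≢0 m k {{m*n≢0 (suc x + U) (suc x + U)}}}}}} (begin
      A ^ k * 2 ^ (24 * j * r) * (m ^ k) ^ r    ≡⟨ cong (λ z → A ^ k * z * (m ^ k) ^ r) (^-*-assoc 2 (24 * j) r) ⟨
      A ^ k * (2 ^ (24 * j)) ^ r * (m ^ k) ^ r  ≡⟨ trans (*-assoc (A ^ k) ((2 ^ (24 * j)) ^ r) ((m ^ k) ^ r))
                                                     (cong (A ^ k *_) (sym (^-distribʳ-* (2 ^ (24 * j)) (m ^ k) r))) ⟩
      A ^ k * (2 ^ (24 * j) * m ^ k) ^ r        ≤⟨ *-monoʳ-≤ (A ^ k) (^-monoˡ-≤ r (2^24j*m^5m≤[m+4j]^5m j m 10j≤m)) ⟩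
      A ^ k * ((m + 4 * j) ^ k) ^ r             ≡⟨ cong (A ^ k *_) (^-*-comm (m + 4 * j) k r) ⟩
      A ^ k * ((m + 4 * j) ^ r) ^ k             ≡⟨ ^-distribʳ-* A ((m + 4 * j) ^ r) k ⟨
      (A * (m + 4 * j) ^ r) ^ k                 ≤⟨ ^-monoˡ-≤ k (binary-step R S x U j balance) ⟩
      (B * m ^ r) ^ k                           ≡⟨ ^-distribʳ-* B (m ^ r) k ⟩
      B ^ k * (m ^ r) ^ k                       ≡⟨ cong (B ^ k *_) (^-*-comm m r k) ⟩
      B ^ k * (m ^ k) ^ r                       ∎)
    where
    r = R + S
    m = (suc x + U) * (suc x + U)
    k = 5 * m
    A = x ^ R * suc U ^ S
    B = suc x ^ R * U ^ S

  triangle : ℕ → ℕ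
  triangle zero    = 0
  triangle (suc j) = j + triangle j

  2*triangle[M]+M≡M*M : ∀ M → 2 * triangle M + M ≡ M * M
  2*triangle[M]+M≡M*M zero    = refl
  2*triangle[M]+M≡M*M (suc M) = begin-equality
    2 * (M + triangle M) + suc M   ≡⟨ e₁ M (triangle M) ⟩
    2 * triangle M + M + (2 * M + 1) ≡⟨ cong (_+ (2 * M + 1)) (2*triangle[M]+M≡M*M M) ⟩
    M * M + (2 * M + 1)            ≡⟨ e₂ M ⟩
    suc M * suc M                  ∎
    where
    e₁ : ∀ M t → 2 * (M + t) + suc M ≡ 2 * t + M + (2 * M + 1)
    e₁ = solve-∀
    e₂ : ∀ M → M * M + (2 * M + 1) ≡ suc M * suc M
    e₂ = solve-∀

  1000*e*e≤24*triangle[10e] : ∀ e → 1000 * (e * e) ≤ 24 * triangle (10 * e)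
  1000*e*e≤24*triangle[10e] e = *-cancelˡ-≤ 2 (+-cancelʳ-≤ (240 * e) _ _ (begin
    2 * (1000 * (e * e)) + 240 * e          ≤⟨ +-monoʳ-≤ (2 * (1000 * (e * e))) (*-mono-≤ (m≤m+n 240 160) (m≤m*m e)) ⟩
    2 * (1000 * (e * e)) + 400 * (e * e)    ≡⟨ e₁ e ⟩
    24 * (10 * e * (10 * e))                ≡⟨ cong (24 *_) (2*triangle[M]+M≡M*M (10 * e)) ⟨
    24 * (2 * triangle (10 * e) + 10 * e)   ≡⟨ e₂ (triangle (10 * e)) e ⟩
    2 * (24 * triangle (10 * e)) + 240 * e  ∎))
    where
    e₁ : ∀ e → 2 * (1000 * (e * e)) + 400 * (e * e) ≡ 24 * (10 * e * (10 * e))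
    e₁ = solve-∀
    e₂ : ∀ t e → 24 * (2 * t + 10 * e) ≡ 2 * (24 * t) + 240 * e
    e₂ = solve-∀

  -- Summing binary-step₂ along the path from (a, b + M) to (a + M, b), whose endpoint
  -- is proportional to (R, S).
  binary-pinsker : ∀ R S n M a b → a + M + b ≡ n → R * b ≡ S * (a + M) → 10 * M ≤ n * n →
    (a ^ R * (b + M) ^ S) ^ (5 * (n * n)) * 2 ^ (24 * (R + S) * triangle M)
    ≤ ((a + M) ^ R * b ^ S) ^ (5 * (n * n))
  binary-pinsker R S n zero a b _ _ _
    rewrite +-identityʳ a | +-identityʳ b | *-zeroʳ (24 * (R + S)) = ≤-reflexive (*-identityʳ _)
  binary-pinsker R S n (suc M) a b path balance 10M≤m = begin
    (a ^ R * (b + suc M) ^ S) ^ k * 2 ^ (24 * r * (M + triangle M))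
      ≡⟨ cong₂ (λ u v → (a ^ R * u ^ S) ^ k * v) (+-suc b M) split-exponent ⟩
    (a ^ R * suc (b + M) ^ S) ^ k * (2 ^ (24 * M * r) * 2 ^ (24 * r * triangle M))
      ≡⟨ *-assoc ((a ^ R * suc (b + M) ^ S) ^ k) (2 ^ (24 * M * r)) (2 ^ (24 * r * triangle M)) ⟨
    (a ^ R * suc (b + M) ^ S) ^ k * 2 ^ (24 * M * r) * 2 ^ (24 * r * triangle M)
      ≤⟨ *-monoˡ-≤ (2 ^ (24 * r * triangle M)) (binary-step₂ R S a (b + M) M n path′ balance′ (≤-trans (*-monoʳ-≤ 10 (n≤1+n M)) 10M≤m)) ⟩
    (suc a ^ R * (b + M) ^ S) ^ k * 2 ^ (24 * r * triangle M)
      ≤⟨ binary-pinsker R S n M (suc a) b (trans (cong (_+ b) (sym (+-suc a M))) path) (trans balance (cong (S *_) (+-suc a M)))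
           (≤-trans (*-monoʳ-≤ 10 (n≤1+n M)) 10M≤m) ⟩
    ((suc a + M) ^ R * b ^ S) ^ k
      ≡⟨ cong (λ u → (u ^ R * b ^ S) ^ k) (+-suc a M) ⟨
    ((a + suc M) ^ R * b ^ S) ^ k ∎
    where
    r = R + S
    k = 5 * (n * n)
    split-exponent : 2 ^ (24 * r * (M + triangle M)) ≡ 2 ^ (24 * M * r) * 2 ^ (24 * r * triangle M)
    split-exponent = trans (cong (2 ^_) (e₁ r M (triangle M))) (^-distribˡ-+-* 2 (24 * M * r) (24 * r * triangle M))
      where
      e₁ : ∀ r M t → 24 * r * (M + t) ≡ 24 * M * r + 24 * r * t
      e₁ = solve-∀
    path′ : suc a + (b + M) ≡ n
    path′ = trans (e₁ a b M) path
      where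
      e₁ : ∀ a b M → suc a + (b + M) ≡ a + suc M + b
      e₁ = solve-∀
    balance′ : R * (b + M) ≡ S * suc a + (R + S) * M
    balance′ = begin-equality
      R * (b + M)                  ≡⟨ *-distribˡ-+ R b M ⟩
      R * b + R * M                ≡⟨ cong (_+ R * M) balance ⟩
      S * (a + suc M) + R * M      ≡⟨ e₁ R S a M ⟩
      S * suc a + (R + S) * M      ∎
      where
      e₁ : ∀ R S a M → S * (a + suc M) + R * M ≡ S * suc a + (R + S) * M
      e₁ = solve-∀

module NodePinsker where

  open import Data.Nat
  open import Data.Nat.Properties
  open import Data.Nat.Tactic.RingSolver using (solve-∀)
  open import Data.Bool using (Bool; true; false; not; if_then_else_)
  open import Data.Fin using (Fin)
  open import Relation.Binary.PropositionalEquality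
  open import Relation.Nullary using (Dec; yes; no; does)
  open FinBigOperators
  open PowerInequalities
  open LogSumInequality
  open BinaryPinsker
  open ≤-Reasoning

  -- For the red counts f of the children of a node x of height h,
  -- deviation k f = k^h Σ_{y ∈ child(x)} |μ(T_y) − μ(T_x)|.
  deviation : (k : ℕ) → (Fin k → ℕ) → ℕ
  deviation k f = Σℕfin k (λ i → ∣ k * f i - Σℕfin k f ∣)

  selfPowers : (k : ℕ) → (Fin k → ℕ) → ℕ
  selfPowers k f = Πℕfin k (λ i → f i ^ f i)

  infix 9 _onlyIf_
  _onlyIf_ : ℕ → Bool → ℕ
  x onlyIf b = if b then x else 0

  selfPowers≢0 : ∀ k (f : Fin k → ℕ) → NonZero (selfPowers k f)
  selfPowers≢0 k f = Πℕfin≢0 k _ (λ i → n^n≢0 (f i))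

  private
    onlyIf-split : ∀ b x → x onlyIf b + x onlyIf not b ≡ x
    onlyIf-split true  x = +-identityʳ x
    onlyIf-split false x = refl

    *-onlyIf : ∀ b c x → c * x onlyIf b ≡ (c * x) onlyIf b
    *-onlyIf true  c x = refl
    *-onlyIf false c x = *-zeroʳ c

    *-onlyIf-1 : ∀ b c → c * 1 onlyIf b ≡ c onlyIf b
    *-onlyIf-1 true  c = *-identityʳ c
    *-onlyIf-1 false c = *-zeroʳ c

    two-point-power : ∀ c x y z R S →
      (c * (x * y)) ^ R * (c * (x * z)) ^ S ≡ c ^ (R + S) * x ^ (R + S) * (y ^ R * z ^ S)
    two-point-power c x y z R S = begin-equality
      (c * (x * y)) ^ R * (c * (x * z)) ^ S
        ≡⟨ cong₂ _*_ (trans (^-distribʳ-* c (x * y) R) (cong (c ^ R *_) (^-distribʳ-* x y R)))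
                     (trans (^-distribʳ-* c (x * z) S) (cong (c ^ S *_) (^-distribʳ-* x z S))) ⟩
      c ^ R * (x ^ R * y ^ R) * (c ^ S * (x ^ S * z ^ S))
        ≡⟨ e₁ (c ^ R) (x ^ R) (y ^ R) (c ^ S) (x ^ S) (z ^ S) ⟩
      c ^ R * c ^ S * (x ^ R * x ^ S) * (y ^ R * z ^ S)
        ≡⟨ cong₂ (λ u v → u * v * (y ^ R * z ^ S)) (^-distribˡ-+-* c R S) (^-distribˡ-+-* x R S) ⟨
      c ^ (R + S) * x ^ (R + S) * (y ^ R * z ^ S) ∎
      where
      e₁ : ∀ a b c d e f → a * (b * c) * (d * (e * f)) ≡ a * d * (b * e) * (c * f)
      e₁ = solve-∀

    onlyIf-^-onlyIf : ∀ b x → (1 onlyIf b) ^ (x onlyIf b) ≡ 1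
    onlyIf-^-onlyIf true  x = ^-zeroˡ x
    onlyIf-^-onlyIf false x = refl

    onlyIf-selfPower-split : ∀ b x → (x onlyIf b) ^ (x onlyIf b) * (x onlyIf not b) ^ (x onlyIf not b) ≡ x ^ x
    onlyIf-selfPower-split true  x = *-identityʳ (x ^ x)
    onlyIf-selfPower-split false x = *-identityˡ (x ^ x)

    excess-split : ∀ {c x} (c≤?x : Dec (c ≤ x)) →
                   x onlyIf does c≤?x ≡ c onlyIf does c≤?x + (x ∸ c) onlyIf does c≤?x
    excess-split (yes c≤x) = sym (m+[n∸m]≡n c≤x)
    excess-split (no  _)   = refl

    deficit-split : ∀ {c x} (c≤?x : Dec (c ≤ x)) →
                    c onlyIf not (does c≤?x) ≡ x onlyIf not (does c≤?x) + (c ∸ x) onlyIf not (does c≤?x)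
    deficit-split (yes _)   = refl
    deficit-split (no  c≰x) = sym (m+[n∸m]≡n (<⇒≤ (≰⇒> c≰x)))

    ∣-∣-split : ∀ {c x} (c≤?x : Dec (c ≤ x)) →
                ∣ x - c ∣ ≡ (x ∸ c) onlyIf does c≤?x + (c ∸ x) onlyIf not (does c≤?x)
    ∣-∣-split (yes c≤x) = trans (m≤n⇒∣n-m∣≡n∸m c≤x) (sym (+-identityʳ _))
    ∣-∣-split (no  c≰x) = m≤n⇒∣m-n∣≡n∸m (<⇒≤ (≰⇒> c≰x))

  -- Merging the heavy children (k f i ≥ r) and the light ones reduces Pinsker's inequality to
  -- two points, by the log-sum inequality; the deviation is twice the excess of the heavy ones.
  module Split {k : ℕ} (f : Fin k → ℕ) where

    r : ℕ
    r = Σℕfin k f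

    heavy? : ∀ i → Dec (r ≤ k * f i)
    heavy? i = r ≤? k * f i

    heavy light : Fin k → Bool
    heavy i = does (heavy? i)
    light i = not (heavy i)

    Σ[_] : (Fin k → Bool) → (Fin k → ℕ) → ℕ
    Σ[ b ] x = Σℕfin k (λ i → x i onlyIf b i)

    Π[_] : (Fin k → Bool) → (Fin k → ℕ) → ℕ
    Π[ b ] x = Πℕfin k (λ i → x i onlyIf b i ^ x i onlyIf b i)

    R S g g′ excess deficit : ℕ
    R       = Σ[ heavy ] f
    S       = Σ[ light ] f
    g       = Σ[ heavy ] (λ _ → 1)
    g′      = Σ[ light ] (λ _ → 1)
    excess  = Σ[ heavy ] (λ i → k * f i ∸ r)
    deficit = Σ[ light ] (λ i → r ∸ k * f i)

    *-Σ[] : ∀ b c x → c * Σ[ b ] x ≡ Σ[ b ] (λ i → c * x i)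
    *-Σ[] b c x = trans (sym (Σℕfin-*ˡ k c _)) (Σℕfin-cong k (λ i → *-onlyIf (b i) c (x i)))

    *-Σ[]-1 : ∀ b c → c * Σ[ b ] (λ _ → 1) ≡ Σℕfin k (λ i → c onlyIf b i)
    *-Σ[]-1 b c = trans (sym (Σℕfin-*ˡ k c _)) (Σℕfin-cong k (λ i → *-onlyIf-1 (b i) c))

    R+S≡r : R + S ≡ r
    R+S≡r = trans (sym (Σℕfin-+ k _ _)) (Σℕfin-cong k (λ i → onlyIf-split (heavy i) (f i)))

    g+g′≡k : g + g′ ≡ k
    g+g′≡k = trans (sym (Σℕfin-+ k _ _)) (trans (Σℕfin-cong k (λ i → onlyIf-split (heavy i) 1))
                                                 (trans (Σℕfin-const k 1) (*-identityʳ k)))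

    kR≡rg+excess : k * R ≡ r * g + excess
    kR≡rg+excess = begin-equality
      k * R                                                       ≡⟨ *-Σ[] heavy k f ⟩
      Σ[ heavy ] (λ i → k * f i)                                  ≡⟨ Σℕfin-cong k (λ i → excess-split (heavy? i)) ⟩
      Σℕfin k (λ i → r onlyIf heavy i + (k * f i ∸ r) onlyIf heavy i) ≡⟨ Σℕfin-+ k _ _ ⟩
      Σℕfin k (λ i → r onlyIf heavy i) + excess                   ≡⟨ cong (_+ excess) (*-Σ[]-1 heavy r) ⟨
      r * g + excess                                              ∎

    rg′≡kS+deficit : r * g′ ≡ k * S + deficit
    rg′≡kS+deficit = begin-equality
      r * g′                                                      ≡⟨ *-Σ[]-1 light r ⟩
      Σℕfin k (λ i → r onlyIf light i)                            ≡⟨ Σℕfin-cong k (λ i → deficit-split (heavy? i)) ⟩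
      Σℕfin k (λ i → (k * f i) onlyIf light i + (r ∸ k * f i) onlyIf light i) ≡⟨ Σℕfin-+ k _ _ ⟩
      Σ[ light ] (λ i → k * f i) + deficit                        ≡⟨ cong (_+ deficit) (*-Σ[] light k f) ⟨
      k * S + deficit                                             ∎

    deficit≡excess : deficit ≡ excess
    deficit≡excess = sym (+-cancelˡ-≡ (r * g + k * S) excess deficit (begin-equality
      r * g + k * S + excess      ≡⟨ e₁ (r * g) (k * S) excess ⟩
      r * g + excess + k * S      ≡⟨ cong (_+ k * S) kR≡rg+excess ⟨
      k * R + k * S               ≡⟨ *-distribˡ-+ k R S ⟨
      k * (R + S)                 ≡⟨ cong (k *_) R+S≡r ⟩
      k * r                       ≡⟨ *-comm k r ⟩
      r * k                       ≡⟨ cong (r *_) g+g′≡k ⟨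
      r * (g + g′)                ≡⟨ *-distribˡ-+ r g g′ ⟩
      r * g + r * g′              ≡⟨ cong (r * g +_) rg′≡kS+deficit ⟩
      r * g + (k * S + deficit)   ≡⟨ +-assoc (r * g) (k * S) deficit ⟨
      r * g + k * S + deficit     ∎))
      where
      e₁ : ∀ a b c → a + b + c ≡ a + c + b
      e₁ = solve-∀

    deviation≡2*excess : deviation k f ≡ 2 * excess
    deviation≡2*excess = begin-equality
      deviation k f      ≡⟨ Σℕfin-cong k (λ i → ∣-∣-split (heavy? i)) ⟩
      _                  ≡⟨ Σℕfin-+ k _ _ ⟩
      excess + deficit   ≡⟨ cong (excess +_) deficit≡excess ⟩
      excess + excess    ≡⟨ cong (excess +_) (+-identityʳ excess) ⟨
      2 * excess         ∎

    gibbs : ∀ p → Σ[ p ] f ^ Σ[ p ] f ≤ Π[ p ] f * Σ[ p ] (λ _ → 1) ^ Σ[ p ] f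
    gibbs p = subst (_≤ Π[ p ] f * Σ[ p ] (λ _ → 1) ^ Σ[ p ] f) (trans (cong (Σ[ p ] f ^ Σ[ p ] f *_) weights≡1) (*-identityʳ _))
              (logSum k (λ i → f i onlyIf p i) (λ i → 1 onlyIf p i))
      where
      weights≡1 : Πℕfin k (λ i → 1 onlyIf p i ^ f i onlyIf p i) ≡ 1
      weights≡1 = trans (Πℕfin-cong k (λ i → onlyIf-^-onlyIf (p i) (f i))) (trans (Πℕfin-const k 1) (^-zeroˡ k))

    G : ℕ
    G = g ^ R * g′ ^ S

    G≢0 : NonZero G
    G≢0 = m*n≢0 (g ^ R) (g′ ^ S) {{m*n≢0⇒n≢0 (Π[ heavy ] f) {{≤-nonZero {{n^n≢0 R}} (gibbs heavy)}}}}
                                 {{m*n≢0⇒n≢0 (Π[ light ] f) {{≤-nonZero {{n^n≢0 S}} (gibbs light)}}}}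

    grouped-gibbs : R ^ R * S ^ S ≤ G * selfPowers k f
    grouped-gibbs = begin
      R ^ R * S ^ S                          ≤⟨ *-mono-≤ (gibbs heavy) (gibbs light) ⟩
      Π[ heavy ] f * g ^ R * (Π[ light ] f * g′ ^ S) ≡⟨ e₁ (Π[ heavy ] f) (g ^ R) (Π[ light ] f) (g′ ^ S) ⟩
      G * (Π[ heavy ] f * Π[ light ] f)      ≡⟨ cong (G *_) (trans (sym (Πℕfin-* k _ _))
                                                  (Πℕfin-cong k (λ i → onlyIf-selfPower-split (heavy i) (f i)))) ⟩
      G * selfPowers k f                     ∎
      where
      e₁ : ∀ a b c d → a * b * (c * d) ≡ b * d * (a * c)
      e₁ = solve-∀

    -- The factor 10 makes 10 M ≤ n * n hold for every k.
    n a b M : ℕ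
    n = 10 * (k * r)
    a = 10 * (r * g)
    b = 10 * (k * S)
    M = 10 * excess

    a+M≡10kR : a + M ≡ 10 * (k * R)
    a+M≡10kR = trans (sym (*-distribˡ-+ 10 (r * g) excess)) (cong (10 *_) (sym kR≡rg+excess))

    b+M≡10rg′ : b + M ≡ 10 * (r * g′)
    b+M≡10rg′ = trans (sym (*-distribˡ-+ 10 (k * S) excess))
                      (cong (10 *_) (trans (cong (k * S +_) (sym deficit≡excess)) (sym rg′≡kS+deficit)))

    a+M+b≡n : a + M + b ≡ n
    a+M+b≡n = begin-equality
      a + M + b               ≡⟨ cong (_+ b) a+M≡10kR ⟩
      10 * (k * R) + b        ≡⟨ *-distribˡ-+ 10 (k * R) (k * S) ⟨
      10 * (k * R + k * S)    ≡⟨ cong (10 *_) (trans (sym (*-distribˡ-+ k R S)) (cong (k *_) R+S≡r)) ⟩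
      n                       ∎

    Rb≡S[a+M] : R * b ≡ S * (a + M)
    Rb≡S[a+M] = trans (e₁ R S k) (cong (S *_) (sym a+M≡10kR))
      where
      e₁ : ∀ R S k → R * (10 * (k * S)) ≡ S * (10 * (k * R))
      e₁ = solve-∀

    10M≤n*n : 10 * M ≤ n * n
    10M≤n*n = begin
      10 * (10 * excess)              ≤⟨ *-monoʳ-≤ 10 (*-monoʳ-≤ 10 (begin
          excess             ≤⟨ m≤n+m excess (r * g) ⟩
          r * g + excess     ≡⟨ kR≡rg+excess ⟨
          k * R              ≤⟨ *-monoʳ-≤ k (subst (R ≤_) R+S≡r (m≤m+n R S)) ⟩
          k * r              ≤⟨ m≤m*m (k * r) ⟩
          k * r * (k * r)    ∎)) ⟩
      10 * (10 * (k * r * (k * r)))   ≡⟨ e₁ (k * r) ⟩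
      n * n                           ∎
      where
      e₁ : ∀ x → 10 * (10 * (x * x)) ≡ 10 * x * (10 * x)
      e₁ = solve-∀

    telescope-start : a ^ R * (b + M) ^ S ≡ 10 ^ r * G * r ^ r
    telescope-start = begin-equality
      a ^ R * (b + M) ^ S                      ≡⟨ cong (λ u → a ^ R * u ^ S) b+M≡10rg′ ⟩
      a ^ R * (10 * (r * g′)) ^ S              ≡⟨ two-point-power 10 r g g′ R S ⟩
      10 ^ (R + S) * r ^ (R + S) * G           ≡⟨ cong (λ t → 10 ^ t * r ^ t * G) R+S≡r ⟩
      10 ^ r * r ^ r * G                       ≡⟨ e₁ (10 ^ r) (r ^ r) G ⟩
      10 ^ r * G * r ^ r                       ∎
      where
      e₁ : ∀ x y z → x * y * z ≡ x * z * y
      e₁ = solve-∀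

    telescope-end : (a + M) ^ R * b ^ S ≡ 10 ^ r * k ^ r * (R ^ R * S ^ S)
    telescope-end = begin-equality
      (a + M) ^ R * b ^ S                          ≡⟨ cong (λ u → u ^ R * b ^ S) a+M≡10kR ⟩
      (10 * (k * R)) ^ R * b ^ S                   ≡⟨ two-point-power 10 k R S R S ⟩
      10 ^ (R + S) * k ^ (R + S) * (R ^ R * S ^ S) ≡⟨ cong (λ t → 10 ^ t * k ^ t * (R ^ R * S ^ S)) R+S≡r ⟩
      10 ^ r * k ^ r * (R ^ R * S ^ S)             ∎

    pinsker-scaled : (r ^ r) ^ (5 * (n * n)) * 2 ^ (24 * r * triangle M) ≤ (k ^ r * selfPowers k f) ^ (5 * (n * n))
    pinsker-scaled = *-cancelˡ-≤ ((10 ^ r * G) ^ K) {{m^n≢0 (10 ^ r * G) K {{m*n≢0 (10 ^ r) G {{m^n≢0 10 r}} {{G≢0}}}}}} (begin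
      (10 ^ r * G) ^ K * ((r ^ r) ^ K * 2 ^ E)
        ≡⟨ trans (cong (_* 2 ^ E) (^-distribʳ-* (10 ^ r * G) (r ^ r) K))
                 (*-assoc ((10 ^ r * G) ^ K) ((r ^ r) ^ K) (2 ^ E)) ⟨
      (10 ^ r * G * r ^ r) ^ K * 2 ^ E
        ≡⟨ cong₂ (λ u v → u ^ K * 2 ^ v) (sym telescope-start) (cong (λ t → 24 * t * triangle M) (sym R+S≡r)) ⟩
      (a ^ R * (b + M) ^ S) ^ K * 2 ^ (24 * (R + S) * triangle M)
        ≤⟨ binary-pinsker R S n M a b a+M+b≡n Rb≡S[a+M] 10M≤n*n ⟩
      ((a + M) ^ R * b ^ S) ^ K
        ≡⟨ cong (_^ K) telescope-end ⟩
      (10 ^ r * k ^ r * (R ^ R * S ^ S)) ^ K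
        ≤⟨ ^-monoˡ-≤ K (*-monoʳ-≤ (10 ^ r * k ^ r) grouped-gibbs) ⟩
      (10 ^ r * k ^ r * (G * selfPowers k f)) ^ K
        ≡⟨ cong (_^ K) (e₁ (10 ^ r) (k ^ r) G (selfPowers k f)) ⟩
      (10 ^ r * G * (k ^ r * selfPowers k f)) ^ K
        ≡⟨ ^-distribʳ-* (10 ^ r * G) (k ^ r * selfPowers k f) K ⟩
      (10 ^ r * G) ^ K * (k ^ r * selfPowers k f) ^ K ∎)
      where
      K = 5 * (n * n)
      E = 24 * r * triangle M
      e₁ : ∀ x y z u → x * y * (z * u) ≡ x * z * (y * u)
      e₁ = solve-∀

    deviation≡0 : r ≡ 0 → deviation k f ≡ 0
    deviation≡0 r≡0 = trans deviation≡2*excess (cong (2 *_) excess≡0)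
      where
      R≡0 : R ≡ 0
      R≡0 = n≤0⇒n≡0 (subst (R ≤_) (trans R+S≡r r≡0) (m≤m+n R S))
      excess≡0 : excess ≡ 0
      excess≡0 = n≤0⇒n≡0 (begin
        excess          ≤⟨ m≤n+m excess (r * g) ⟩
        r * g + excess  ≡⟨ kR≡rg+excess ⟨
        k * R           ≡⟨ cong (k *_) R≡0 ⟩
        k * 0           ≡⟨ *-zeroʳ k ⟩
        0               ∎)

    pinsker⁺ : .{{_ : NonZero r}} →
      (r ^ r) ^ (2 * k * k * r) * 2 ^ (deviation k f * deviation k f) ≤ (k ^ r * selfPowers k f) ^ (2 * k * k * r)
    pinsker⁺ = ^-cancelʳ-≤ (250 * r) {{m*n≢0 250 r}} (begin
      ((r ^ r) ^ (2 * k * k * r) * 2 ^ (A * A)) ^ (250 * r)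
        ≡⟨ trans (^-distribʳ-* ((r ^ r) ^ (2 * k * k * r)) (2 ^ (A * A)) (250 * r))
                 (cong₂ _*_ (^-*-assoc (r ^ r) (2 * k * k * r) (250 * r)) (^-*-assoc 2 (A * A) (250 * r))) ⟩
      (r ^ r) ^ (2 * k * k * r * (250 * r)) * 2 ^ (A * A * (250 * r))
        ≡⟨ cong₂ (λ u v → (r ^ r) ^ u * 2 ^ v) (e₁ k r) (trans (cong (λ a → a * a * (250 * r)) deviation≡2*excess) (e₂ excess r)) ⟩
      (r ^ r) ^ (5 * (n * n)) * 2 ^ (r * (1000 * (excess * excess)))
        ≤⟨ *-monoʳ-≤ ((r ^ r) ^ (5 * (n * n))) (^-monoʳ-≤ 2 (subst (r * (1000 * (excess * excess)) ≤_) (e₃ r (triangle M))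
             (*-monoʳ-≤ r (1000*e*e≤24*triangle[10e] excess)))) ⟩
      (r ^ r) ^ (5 * (n * n)) * 2 ^ (24 * r * triangle M)
        ≤⟨ pinsker-scaled ⟩
      (k ^ r * selfPowers k f) ^ (5 * (n * n))
        ≡⟨ trans (^-*-assoc (k ^ r * selfPowers k f) (2 * k * k * r) (250 * r)) (cong ((k ^ r * selfPowers k f) ^_) (e₁ k r)) ⟨
      ((k ^ r * selfPowers k f) ^ (2 * k * k * r)) ^ (250 * r) ∎)
      where
      A = deviation k f
      e₁ : ∀ k r → 2 * k * k * r * (250 * r) ≡ 5 * (10 * (k * r) * (10 * (k * r)))
      e₁ = solve-∀
      e₂ : ∀ e r → 2 * e * (2 * e) * (250 * r) ≡ r * (1000 * (e * e))
      e₂ = solve-∀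
      e₃ : ∀ r t → r * (24 * t) ≡ 24 * r * t
      e₃ = solve-∀

  -- ‖f/r − uniform‖₁² ≤ 2 D(f/r ‖ uniform) with D in bits, multiplied by k² r² and
  -- exponentiated: r D = log₂ (k ^ r * selfPowers k f / r ^ r).
  pinsker : ∀ k (f : Fin k → ℕ) →
    (Σℕfin k f ^ Σℕfin k f) ^ (2 * k * k * Σℕfin k f) * 2 ^ (deviation k f * deviation k f)
    ≤ (k ^ Σℕfin k f * selfPowers k f) ^ (2 * k * k * Σℕfin k f)
  pinsker k f with Σℕfin k f ≟ 0
  ... | no  r≢0 = Split.pinsker⁺ f {{≢-nonZero r≢0}}
  ... | yes r≡0 = ≤-reflexive (begin-equality
    (r ^ r) ^ (2 * k * k * r) * 2 ^ (deviation k f * deviation k f)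
      ≡⟨ cong₂ (λ u v → u * 2 ^ (v * v)) (power-zero (r ^ r)) (Split.deviation≡0 f r≡0) ⟩
    1 ≡⟨ power-zero (k ^ r * selfPowers k f) ⟨
    (k ^ r * selfPowers k f) ^ (2 * k * k * r) ∎)
    where
    r = Σℕfin k f
    power-zero : ∀ x → x ^ (2 * k * k * r) ≡ 1
    power-zero x = cong (x ^_) (trans (cong (2 * k * k *_) r≡0) (*-zeroʳ (2 * k * k)))

  -- Unlike pinsker, this form multiplies over the nodes of a tree.
  pinsker-linear : ∀ k .{{_ : NonZero k}} (f : Fin k → ℕ) p q →
    Σℕfin k f ^ (Σℕfin k f * (2 * k * (q * q))) * 2 ^ (2 * p * q * deviation k f)
    ≤ (k ^ Σℕfin k f * selfPowers k f) ^ (2 * k * (q * q)) * 2 ^ (k * Σℕfin k f * (p * p))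
  pinsker-linear k f p q with Σℕfin k f ≟ 0
  ... | no r≢0 = ^-cancelʳ-≤ (k * r) {{m*n≢0 k r}} (begin
      (r ^ (r * N) * 2 ^ (2 * p * q * A)) ^ (k * r)
        ≡⟨ lhs≡ ⟩
      ((r ^ r) ^ (2 * k * k * r)) ^ (q * q) * 2 ^ (2 * (q * A) * (k * r * p))
        ≤⟨ amgm-in-exponent ((r ^ r) ^ (2 * k * k * r)) (W ^ (2 * k * k * r)) A (k * r * p) q (pinsker k f) ⟩
      (W ^ (2 * k * k * r)) ^ (q * q) * 2 ^ (k * r * p * (k * r * p))
        ≡⟨ rhs≡ ⟩
      (W ^ N * 2 ^ (k * r * (p * p))) ^ (k * r) ∎)
    where
    r = Σℕfin k f
    A = deviation k f
    W = k ^ r * selfPowers k f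
    N = 2 * k * (q * q)
    instance
      r-nonZero : NonZero r
      r-nonZero = ≢-nonZero r≢0
    lhs≡ : (r ^ (r * N) * 2 ^ (2 * p * q * A)) ^ (k * r)
           ≡ ((r ^ r) ^ (2 * k * k * r)) ^ (q * q) * 2 ^ (2 * (q * A) * (k * r * p))
    lhs≡ = trans (^-distribʳ-* (r ^ (r * N)) (2 ^ (2 * p * q * A)) (k * r)) (cong₂ _*_
      (trans (^-*-assoc r (r * N) (k * r)) (trans (cong (r ^_) (e₁ r k q))
             (sym (trans (^-*-assoc (r ^ r) (2 * k * k * r) (q * q)) (^-*-assoc r r (2 * k * k * r * (q * q)))))))
      (trans (^-*-assoc 2 (2 * p * q * A) (k * r)) (cong (2 ^_) (e₂ p q A k r))))
      where
      e₁ : ∀ r k q → r * (2 * k * (q * q)) * (k * r) ≡ r * (2 * k * k * r * (q * q))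
      e₁ = solve-∀
      e₂ : ∀ p q A k r → 2 * p * q * A * (k * r) ≡ 2 * (q * A) * (k * r * p)
      e₂ = solve-∀
    rhs≡ : (W ^ (2 * k * k * r)) ^ (q * q) * 2 ^ (k * r * p * (k * r * p)) ≡ (W ^ N * 2 ^ (k * r * (p * p))) ^ (k * r)
    rhs≡ = trans (cong₂ _*_
      (trans (^-*-assoc W (2 * k * k * r) (q * q)) (trans (cong (W ^_) (e₃ k r q)) (sym (^-*-assoc W N (k * r)))))
      (trans (cong (2 ^_) (e₄ k r p)) (sym (^-*-assoc 2 (k * r * (p * p)) (k * r)))))
      (sym (^-distribʳ-* (W ^ N) (2 ^ (k * r * (p * p))) (k * r)))
      where
      e₃ : ∀ k r q → 2 * k * k * r * (q * q) ≡ 2 * k * (q * q) * (k * r)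
      e₃ = solve-∀
      e₄ : ∀ k r p → k * r * p * (k * r * p) ≡ k * r * (p * p) * (k * r)
      e₄ = solve-∀
  ... | yes r≡0 = ≤-trans (≤-reflexive lhs≡1) (>-nonZero⁻¹ _ {{rhs≢0}})
    where
    r = Σℕfin k f
    N = 2 * k * (q * q)
    lhs≡1 : r ^ (r * N) * 2 ^ (2 * p * q * deviation k f) ≡ 1
    lhs≡1 = trans (cong₂ (λ u v → u ^ (u * N) * 2 ^ (2 * p * q * v)) r≡0 (Split.deviation≡0 f r≡0))
                  (cong (λ t → 1 * 2 ^ t) (*-zeroʳ (2 * p * q)))
    rhs≢0 : NonZero ((k ^ r * selfPowers k f) ^ N * 2 ^ (k * r * (p * p)))
    rhs≢0 = m*n≢0 _ _ {{m^n≢0 _ N {{m*n≢0 (k ^ r) _ {{m^n≢0 k r}} {{selfPowers≢0 k f}}}}}} {{m^n≢0 2 (k * r * (p * p))}}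

module PinskerChain where

  open import Data.Nat
  open import Data.Nat.Properties
  open import Data.Nat.Tactic.RingSolver using (solve-∀)
  open import Data.Bool using (true; false)
  open import Data.Fin using (Fin)
  open import Relation.Binary.PropositionalEquality
  open import Defs using (Tree; reds)
  open PowerInequalities
  open FinBigOperators
  open NodePinsker
  open ≤-Reasoning

  totalDeviation : ∀ k d → Tree k d → ℕ
  totalDeviation k zero    T = 0
  totalDeviation k (suc d) T =
    deviation k (λ i → reds k d (T i)) + Σℕfin k (λ i → totalDeviation k d (T i))

  -- Multiplying pinsker-linear over all internal nodes: the factors selfPowers of a node
  -- and r ^ r of its children cancel.
  pinsker-chain : ∀ k .{{_ : NonZero k}} p q d (T : Tree k d) →
    reds k d T ^ (reds k d T * (2 * k * (q * q))) * 2 ^ (2 * p * q * totalDeviation k d T)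
    ≤ k ^ (d * reds k d T * (2 * k * (q * q))) * 2 ^ (k * d * reds k d T * (p * p))
  pinsker-chain k p q zero true = begin
    1 ^ (1 * N) * 2 ^ (2 * p * q * 0)  ≡⟨ cong₂ (λ u v → u * 2 ^ v) (^-zeroˡ (1 * N)) (*-zeroʳ (2 * p * q)) ⟩
    1                                  ≤⟨ >-nonZero⁻¹ (2 ^ (k * 0 * 1 * (p * p))) {{m^n≢0 2 (k * 0 * 1 * (p * p))}} ⟩
    2 ^ (k * 0 * 1 * (p * p))          ≡⟨ *-identityˡ _ ⟨
    1 * 2 ^ (k * 0 * 1 * (p * p))      ∎
    where N = 2 * k * (q * q)
  pinsker-chain k p q zero false = begin
    1 * 2 ^ (2 * p * q * 0)            ≡⟨ cong (λ v → 1 * 2 ^ v) (*-zeroʳ (2 * p * q)) ⟩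
    1                                  ≤⟨ >-nonZero⁻¹ (2 ^ (k * 0 * 0 * (p * p))) {{m^n≢0 2 (k * 0 * 0 * (p * p))}} ⟩
    2 ^ (k * 0 * 0 * (p * p))          ≡⟨ *-identityˡ _ ⟨
    1 * 2 ^ (k * 0 * 0 * (p * p))      ∎
  pinsker-chain k p q (suc d) T = *-cancelˡ-≤ (P ^ N) {{m^n≢0 P N {{selfPowers≢0 k f}}}} (begin
    P ^ N * (r ^ (r * N) * 2 ^ (c * (A₀ + ΣA)))                   ≡⟨ split-node ⟩
    r ^ (r * N) * 2 ^ (c * A₀) * Πℕfin k below                     ≤⟨ *-mono-≤ (pinsker-linear k f p q)
                                                                         (Πℕfin-mono-≤ k (λ i → pinsker-chain k p q d (T i))) ⟩
    (k ^ r * P) ^ N * 2 ^ (k * r * (p * p)) * Πℕfin k above        ≡⟨ merge-node ⟩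
    P ^ N * (k ^ (suc d * r * N) * 2 ^ (k * suc d * r * (p * p)))  ∎)
    where
    f : Fin k → ℕ
    f i = reds k d (T i)
    r = Σℕfin k f
    P = selfPowers k f
    N = 2 * k * (q * q)
    c = 2 * p * q
    A₀ = deviation k f
    ΣA = Σℕfin k (λ i → totalDeviation k d (T i))
    below above : Fin k → ℕ
    below i = f i ^ (f i * N) * 2 ^ (c * totalDeviation k d (T i))
    above i = k ^ (d * f i * N) * 2 ^ (k * d * f i * (p * p))
    split-node : P ^ N * (r ^ (r * N) * 2 ^ (c * (A₀ + ΣA))) ≡ r ^ (r * N) * 2 ^ (c * A₀) * Πℕfin k below
    split-node = begin-equality
      P ^ N * (r ^ (r * N) * 2 ^ (c * (A₀ + ΣA)))
        ≡⟨ cong (λ t → P ^ N * (r ^ (r * N) * t)) (trans (cong (2 ^_) (*-distribˡ-+ c A₀ ΣA)) (^-distribˡ-+-* 2 (c * A₀) (c * ΣA))) ⟩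
      P ^ N * (r ^ (r * N) * (2 ^ (c * A₀) * 2 ^ (c * ΣA)))
        ≡⟨ e₁ (P ^ N) (r ^ (r * N)) (2 ^ (c * A₀)) (2 ^ (c * ΣA)) ⟩
      r ^ (r * N) * 2 ^ (c * A₀) * (P ^ N * 2 ^ (c * ΣA))
        ≡⟨ cong (r ^ (r * N) * 2 ^ (c * A₀) *_) (trans (Πℕfin-* k _ _) (cong₂ _*_
             (trans (Πℕfin-cong k (λ i → sym (^-*-assoc (f i) (f i) N))) (Πℕfin-^ k N (λ i → f i ^ f i)))
             (trans (Πℕfin-^-Σℕfin k 2 _) (cong (2 ^_) (Σℕfin-*ˡ k c _))))) ⟨
      r ^ (r * N) * 2 ^ (c * A₀) * Πℕfin k below ∎
      where
      e₁ : ∀ a b x y → a * (b * (x * y)) ≡ b * x * (a * y)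
      e₁ = solve-∀
    merge-node : (k ^ r * P) ^ N * 2 ^ (k * r * (p * p)) * Πℕfin k above
                 ≡ P ^ N * (k ^ (suc d * r * N) * 2 ^ (k * suc d * r * (p * p)))
    merge-node = begin-equality
      (k ^ r * P) ^ N * 2 ^ (k * r * (p * p)) * Πℕfin k above
        ≡⟨ cong₂ (λ u v → u * 2 ^ (k * r * (p * p)) * v) (trans (^-distribʳ-* (k ^ r) P N) (cong (_* P ^ N) (^-*-assoc k r N)))
             (trans (Πℕfin-* k _ _) (cong₂ _*_
               (trans (Πℕfin-^-Σℕfin k k _) (cong (k ^_) (trans (Σℕfin-cong k (λ i → e₁ d (f i) N)) (Σℕfin-*ˡ k (d * N) f))))
               (trans (Πℕfin-^-Σℕfin k 2 _) (cong (2 ^_) (trans (Σℕfin-cong k (λ i → e₂ k d (f i) (p * p))) (Σℕfin-*ˡ k (k * d * (p * p)) f)))))) ⟩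
      k ^ (r * N) * P ^ N * 2 ^ (k * r * (p * p)) * (k ^ (d * N * r) * 2 ^ (k * d * (p * p) * r))
        ≡⟨ e₃ (k ^ (r * N)) (P ^ N) (2 ^ (k * r * (p * p))) (k ^ (d * N * r)) (2 ^ (k * d * (p * p) * r)) ⟩
      P ^ N * (k ^ (r * N) * k ^ (d * N * r) * (2 ^ (k * r * (p * p)) * 2 ^ (k * d * (p * p) * r)))
        ≡⟨ cong (P ^ N *_) (cong₂ _*_ (trans (sym (^-distribˡ-+-* k (r * N) (d * N * r))) (cong (k ^_) (e₄ r N d)))
             (trans (sym (^-distribˡ-+-* 2 (k * r * (p * p)) (k * d * (p * p) * r))) (cong (2 ^_) (e₅ k r p d)))) ⟩
      P ^ N * (k ^ (suc d * r * N) * 2 ^ (k * suc d * r * (p * p))) ∎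
      where
      e₁ : ∀ d x N → d * x * N ≡ d * N * x
      e₁ = solve-∀
      e₂ : ∀ k d x y → k * d * x * y ≡ k * d * y * x
      e₂ = solve-∀
      e₃ : ∀ a b x y z → a * b * x * (y * z) ≡ b * (a * y * (x * z))
      e₃ = solve-∀
      e₄ : ∀ r N d → r * N + d * N * r ≡ suc d * r * N
      e₄ = solve-∀
      e₅ : ∀ k r p d → k * r * (p * p) + k * d * (p * p) * r ≡ k * suc d * r * (p * p)
      e₅ = solve-∀

  totalDeviation≡0 : ∀ k d (T : Tree k d) → reds k d T ≡ 0 → totalDeviation k d T ≡ 0
  totalDeviation≡0 k zero    T _   = refl
  totalDeviation≡0 k (suc d) T r≡0 = cong₂ _+_ (Split.deviation≡0 (λ i → reds k d (T i)) r≡0) (begin-equality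
    Σℕfin k (λ i → totalDeviation k d (T i))
      ≡⟨ Σℕfin-cong k (λ i → totalDeviation≡0 k d (T i) (Σℕfin≡0⇒≡0 k (λ i → reds k d (T i)) r≡0 i)) ⟩
    Σℕfin k (λ _ → 0)  ≡⟨ Σℕfin-const k 0 ⟩
    k * 0              ≡⟨ *-zeroʳ k ⟩
    0                  ∎)

  -- pinsker-chain at p = A and q = k r d, where a / b = A² / (2 r² d k²).
  2^a*r^b≤k^[d*b] : ∀ k .{{_ : NonZero k}} d .{{_ : NonZero d}} (T : Tree k d) .{{_ : NonZero (reds k d T)}}
    a b .{{_ : NonZero b}} →
    totalDeviation k d T * totalDeviation k d T * b ≡ 2 * a * (reds k d T * reds k d T) * d * (k * k) →
    2 ^ a * reds k d T ^ b ≤ k ^ (d * b)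
  2^a*r^b≤k^[d*b] k d T a b A²b≡2ar²dk² = ^-cancelʳ-≤ (r * N) {{m*n≢0 r N}} (begin
    (2 ^ a * r ^ b) ^ (r * N)      ≡⟨ regroup ⟩
    (r ^ (r * N) * 2 ^ X) ^ b      ≤⟨ ^-monoˡ-≤ b (*-cancelʳ-≤ _ _ (2 ^ X) {{m^n≢0 2 X}} (begin
        r ^ (r * N) * 2 ^ X * 2 ^ X
          ≡⟨ trans (*-assoc (r ^ (r * N)) (2 ^ X) (2 ^ X))
                   (cong (λ t → r ^ (r * N) * t) (trans (sym (^-distribˡ-+-* 2 X X)) (cong (2 ^_) (e₁ k d r A)))) ⟩
        r ^ (r * N) * 2 ^ (2 * A * q * A)          ≤⟨ pinsker-chain k A q d T ⟩
        k ^ (d * r * N) * 2 ^ X                    ∎)) ⟩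
    (k ^ (d * r * N)) ^ b          ≡⟨ trans (^-*-assoc k (d * r * N) b) (trans (cong (k ^_) (e₂ d r N b)) (sym (^-*-assoc k (d * b) (r * N)))) ⟩
    (k ^ (d * b)) ^ (r * N)        ∎)
    where
    r = reds k d T
    A = totalDeviation k d T
    q = k * r * d
    N = 2 * k * (q * q)
    X = k * d * r * (A * A)
    instance
      q≢0 : NonZero q
      q≢0 = m*n≢0 (k * r) d {{m*n≢0 k r}}
      N≢0 : NonZero N
      N≢0 = m*n≢0 (2 * k) (q * q) {{m*n≢0 2 k}} {{m*n≢0 q q}}
    e₁ : ∀ k d r A → k * d * r * (A * A) + k * d * r * (A * A) ≡ 2 * A * (k * r * d) * A
    e₁ = solve-∀
    e₂ : ∀ d r N b → d * r * N * b ≡ d * b * (r * N)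
    e₂ = solve-∀
    Xb≡a[rN] : X * b ≡ a * (r * N)
    Xb≡a[rN] = begin-equality
      k * d * r * (A * A) * b                      ≡⟨ *-assoc (k * d * r) (A * A) b ⟩
      k * d * r * (A * A * b)                      ≡⟨ cong (k * d * r *_) A²b≡2ar²dk² ⟩
      k * d * r * (2 * a * (r * r) * d * (k * k))  ≡⟨ e₃ k d r a ⟩
      a * (r * (2 * k * (k * r * d * (k * r * d)))) ∎
      where
      e₃ : ∀ k d r a → k * d * r * (2 * a * (r * r) * d * (k * k)) ≡ a * (r * (2 * k * (k * r * d * (k * r * d))))
      e₃ = solve-∀
    regroup : (2 ^ a * r ^ b) ^ (r * N) ≡ (r ^ (r * N) * 2 ^ X) ^ b
    regroup = begin-equality
      (2 ^ a * r ^ b) ^ (r * N)             ≡⟨ ^-distribʳ-* (2 ^ a) (r ^ b) (r * N) ⟩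
      (2 ^ a) ^ (r * N) * (r ^ b) ^ (r * N) ≡⟨ cong₂ _*_ (trans (^-*-assoc 2 a (r * N)) (cong (2 ^_) (sym Xb≡a[rN]))) (^-*-comm r b (r * N)) ⟩
      2 ^ (X * b) * (r ^ (r * N)) ^ b       ≡⟨ cong (_* (r ^ (r * N)) ^ b) (^-*-assoc 2 X b) ⟨
      (2 ^ X) ^ b * (r ^ (r * N)) ^ b       ≡⟨ *-comm ((2 ^ X) ^ b) ((r ^ (r * N)) ^ b) ⟩
      (r ^ (r * N)) ^ b * (2 ^ X) ^ b       ≡⟨ ^-distribʳ-* (r ^ (r * N)) (2 ^ X) b ⟨
      (r ^ (r * N) * 2 ^ X) ^ b             ∎
module NatFractions where

  open import Data.Nat as ℕ using (ℕ; zero; suc; NonZero)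
  import Data.Nat.Properties as ℕP
  open import Data.Nat.Tactic.RingSolver using (solve-∀)
  open import Data.Integer as ℤ using (+_)
  import Data.Integer.Properties as ℤP
  open import Data.Rational as ℚ using (ℚ; _/_; toℚᵘ)
  import Data.Rational.Properties as ℚP
  open import Data.Rational.Unnormalised as ℚᵘ using (mkℚᵘ; _≃_; *≡*; *≤*)
  import Data.Rational.Unnormalised.Properties as ℚᵘP
  open import Data.Sum using (inj₁; inj₂)
  open import Relation.Binary.PropositionalEquality
  open import Defs using (_^ℚ_)

  private
    toℚᵘ-/ : ∀ a D .{{_ : NonZero D}} → toℚᵘ (+ a / D) ≃ + a ℚᵘ./ D
    toℚᵘ-/ a (suc D) = ℚP.toℚᵘ-fromℚᵘ (mkℚᵘ (+ a) D)

  /-cross : ∀ a b D E .{{_ : NonZero D}} .{{_ : NonZero E}} → a ℕ.* E ≡ b ℕ.* D → + a / D ≡ + b / E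
  /-cross a b (suc D) (suc E) eq = ℚP.toℚᵘ-injective (ℚᵘP.≃-trans (toℚᵘ-/ a (suc D))
    (ℚᵘP.≃-trans (*≡* (trans (sym (ℤP.pos-* a (suc E))) (trans (cong +_ eq) (ℤP.pos-* b (suc D)))))
                 (ℚᵘP.≃-sym (toℚᵘ-/ b (suc E)))))

  /-cross⁻¹ : ∀ a b D E .{{_ : NonZero D}} .{{_ : NonZero E}} → + a / D ≡ + b / E → a ℕ.* E ≡ b ℕ.* D
  /-cross⁻¹ a b (suc D) (suc E) eq
    with ℚᵘP.≃-trans (ℚᵘP.≃-sym (toℚᵘ-/ a (suc D))) (ℚᵘP.≃-trans (ℚP.toℚᵘ-cong eq) (toℚᵘ-/ b (suc E)))
  ... | *≡* cross = ℤP.+-injective (trans (ℤP.pos-* a (suc E)) (trans cross (sym (ℤP.pos-* b (suc D)))))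

  /-≤ : ∀ a b D E .{{_ : NonZero D}} .{{_ : NonZero E}} → a ℕ.* E ℕ.≤ b ℕ.* D → + a / D ℚ.≤ + b / E
  /-≤ a b (suc D) (suc E) le = ℚP.toℚᵘ-cancel-≤
    (ℚᵘP.≤-respˡ-≃ (ℚᵘP.≃-sym (toℚᵘ-/ a (suc D))) (ℚᵘP.≤-respʳ-≃ (ℚᵘP.≃-sym (toℚᵘ-/ b (suc E)))
      (*≤* (subst₂ ℤ._≤_ (ℤP.pos-* a (suc E)) (ℤP.pos-* b (suc D)) (ℤ.+≤+ le)))))

  /-* : ∀ a b D E .{{_ : NonZero D}} .{{_ : NonZero E}} →
        (+ a / D) ℚ.* (+ b / E) ≡ (+ (a ℕ.* b) / (D ℕ.* E)) {{ℕP.m*n≢0 D E}}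
  /-* a b (suc D) (suc E) = ℚP.toℚᵘ-injective (ℚᵘP.≃-trans (ℚP.toℚᵘ-homo-* (+ a / suc D) (+ b / suc E))
    (ℚᵘP.≃-trans (ℚᵘP.*-cong (toℚᵘ-/ a (suc D)) (toℚᵘ-/ b (suc E)))
      (ℚᵘP.≃-trans (*≡* (cong (ℤ._* + (suc D ℕ.* suc E)) (sym (ℤP.pos-* a b))))
                   (ℚᵘP.≃-sym (toℚᵘ-/ (a ℕ.* b) (suc D ℕ.* suc E))))))

  /-+ : ∀ a b D .{{_ : NonZero D}} → + a / D ℚ.+ + b / D ≡ + (a ℕ.+ b) / D
  /-+ a b (suc D) = ℚP.toℚᵘ-injective (ℚᵘP.≃-trans (ℚP.toℚᵘ-homo-+ (+ a / suc D) (+ b / suc D))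
    (ℚᵘP.≃-trans (ℚᵘP.+-cong (toℚᵘ-/ a (suc D)) (toℚᵘ-/ b (suc D)))
      (ℚᵘP.≃-trans (*≡* cross) (ℚᵘP.≃-sym (toℚᵘ-/ (a ℕ.+ b) (suc D))))))
    where
    s = suc D
    e : ∀ a b s → (a ℕ.* s ℕ.+ b ℕ.* s) ℕ.* s ≡ (a ℕ.+ b) ℕ.* (s ℕ.* s)
    e = solve-∀
    cross : (+ a ℤ.* + s ℤ.+ + b ℤ.* + s) ℤ.* + s ≡ + (a ℕ.+ b) ℤ.* + (s ℕ.* s)
    cross = begin
      (+ a ℤ.* + s ℤ.+ + b ℤ.* + s) ℤ.* + s   ≡⟨ cong (ℤ._* + s) (cong₂ ℤ._+_ (sym (ℤP.pos-* a s)) (sym (ℤP.pos-* b s))) ⟩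
      (+ (a ℕ.* s) ℤ.+ + (b ℕ.* s)) ℤ.* + s   ≡⟨ cong (ℤ._* + s) (ℤP.pos-+ (a ℕ.* s) (b ℕ.* s)) ⟨
      + (a ℕ.* s ℕ.+ b ℕ.* s) ℤ.* + s         ≡⟨ sym (ℤP.pos-* (a ℕ.* s ℕ.+ b ℕ.* s) s) ⟩
      + ((a ℕ.* s ℕ.+ b ℕ.* s) ℕ.* s)         ≡⟨ cong +_ (e a b s) ⟩
      + ((a ℕ.+ b) ℕ.* (s ℕ.* s))             ≡⟨ ℤP.pos-* (a ℕ.+ b) (s ℕ.* s) ⟩
      + (a ℕ.+ b) ℤ.* + (s ℕ.* s)             ∎
      where open ≡-Reasoning

  ∣/-/∣ : ∀ a b D .{{_ : NonZero D}} → ℚ.∣ + a / D ℚ.- + b / D ∣ ≡ + ℕ.∣ a - b ∣ / D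
  ∣/-/∣ a b (suc D) = ℚP.toℚᵘ-injective (ℚᵘP.≃-trans (ℚP.toℚᵘ-homo-∣-∣ (+ a / s ℚ.- + b / s))
    (ℚᵘP.≃-trans (ℚᵘP.∣-∣-cong (ℚᵘP.≃-trans (ℚP.toℚᵘ-homo-+ (+ a / s) (ℚ.- (+ b / s)))
                                 (ℚᵘP.+-cong (toℚᵘ-/ a s) (ℚᵘP.≃-trans (ℚP.toℚᵘ-homo‿- (+ b / s)) (ℚᵘP.-‿cong (toℚᵘ-/ b s))))))
      (ℚᵘP.≃-trans (*≡* cross) (ℚᵘP.≃-sym (toℚᵘ-/ ℕ.∣ a - b ∣ s)))))
    where
    s = suc D
    ∣+m-+n∣ : ∀ m n → ℤ.∣ + m ℤ.+ ℤ.- (+ n) ∣ ≡ ℕ.∣ m - n ∣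
    ∣+m-+n∣ m n with ℕP.≤-total n m
    ... | inj₁ n≤m = trans (cong ℤ.∣_∣ (trans (ℤP.m-n≡m⊖n m n) (ℤP.⊖-≥ n≤m))) (sym (ℕP.m≤n⇒∣n-m∣≡n∸m n≤m))
    ... | inj₂ m≤n = trans (cong ℤ.∣_∣ (trans (ℤP.m-n≡m⊖n m n) (ℤP.⊖-≤ m≤n)))
                           (trans (ℤP.∣-i∣≡∣i∣ (+ (n ℕ.∸ m))) (sym (ℕP.m≤n⇒∣m-n∣≡n∸m m≤n)))
    numerator : ℤ.∣ + a ℤ.* + s ℤ.+ ℤ.- (+ b) ℤ.* + s ∣ ≡ ℕ.∣ a - b ∣ ℕ.* s
    numerator = begin
      ℤ.∣ + a ℤ.* + s ℤ.+ ℤ.- (+ b) ℤ.* + s ∣          ≡⟨ cong ℤ.∣_∣ (cong₂ ℤ._+_ (sym (ℤP.pos-* a s))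
                                                              (trans (sym (ℤP.neg-distribˡ-* (+ b) (+ s))) (cong ℤ.-_ (sym (ℤP.pos-* b s))))) ⟩
      ℤ.∣ + (a ℕ.* s) ℤ.+ ℤ.- (+ (b ℕ.* s)) ∣            ≡⟨ ∣+m-+n∣ (a ℕ.* s) (b ℕ.* s) ⟩
      ℕ.∣ a ℕ.* s - b ℕ.* s ∣                           ≡⟨ ℕP.*-distribʳ-∣-∣ s a b ⟨
      ℕ.∣ a - b ∣ ℕ.* s                                 ∎
      where open ≡-Reasoning
    cross : + ℤ.∣ + a ℤ.* + s ℤ.+ ℤ.- (+ b) ℤ.* + s ∣ ℤ.* + s ≡ + ℕ.∣ a - b ∣ ℤ.* + (s ℕ.* s)
    cross = trans (sym (ℤP.pos-* ℤ.∣ + a ℤ.* + s ℤ.+ ℤ.- (+ b) ℤ.* + s ∣ s))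
                  (trans (cong +_ (trans (cong (ℕ._* s) numerator) (ℕP.*-assoc ℕ.∣ a - b ∣ s s)))
                         (ℤP.pos-* ℕ.∣ a - b ∣ (s ℕ.* s)))

  /-^ : ∀ a D .{{_ : NonZero D}} n → (+ a / D) ^ℚ n ≡ (+ (a ℕ.^ n) / (D ℕ.^ n)) {{ℕP.m^n≢0 D n}}
  /-^ a D zero    = refl
  /-^ a D (suc n) = trans (cong (+ a / D ℚ.*_) (/-^ a D n)) (/-* a (a ℕ.^ n) D (D ℕ.^ n))
    where
    instance
      D^n≢0 : NonZero (D ℕ.^ n)
      D^n≢0 = ℕP.m^n≢0 D n

module ExpectationFormula where

  open import Data.Nat as ℕ using (ℕ; zero; suc; NonZero)
  import Data.Nat.Properties as ℕP
  open import Data.Nat.Tactic.RingSolver using (solve-∀)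
  open import Data.Integer using (+_)
  open import Data.Rational as ℚ using (ℚ; _/_; 0ℚ)
  import Data.Rational.Properties as ℚP
  open import Algebra.Bundles using (CommutativeMonoid)
  open import Algebra.Properties.CommutativeSemigroup
    (CommutativeMonoid.commutativeSemigroup ℚP.+-0-commutativeMonoid) using (interchange)
  open import Data.Fin using (Fin; zero; suc)
  open import Data.Vec using ([]; _∷_)
  open import Data.Product using (_,_)
  open import Function using (_∘_)
  open import Relation.Binary.PropositionalEquality
  open ≡-Reasoning
  open import Defs
  open FinBigOperators using (Σℕfin-const)
  open NodePinsker using (deviation)
  open PinskerChain using (totalDeviation)
  open NatFractions

  Σfin-cong : ∀ n {f g : Fin n → ℚ} → (∀ i → f i ≡ g i) → Σfin n f ≡ Σfin n g
  Σfin-cong zero    eq = refl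
  Σfin-cong (suc n) eq = cong₂ ℚ._+_ (eq zero) (Σfin-cong n (eq ∘ suc))

  Σfin-+ : ∀ n (f g : Fin n → ℚ) → Σfin n (λ i → f i ℚ.+ g i) ≡ Σfin n f ℚ.+ Σfin n g
  Σfin-+ zero    f g = sym (ℚP.+-identityˡ 0ℚ)
  Σfin-+ (suc n) f g = trans (cong (f zero ℚ.+ g zero ℚ.+_) (Σfin-+ n (f ∘ suc) (g ∘ suc))) (interchange (f zero) (g zero) _ _)

  Σfin-*ˡ : ∀ n c (f : Fin n → ℚ) → Σfin n (λ i → c ℚ.* f i) ≡ c ℚ.* Σfin n f
  Σfin-*ˡ zero    c f = sym (ℚP.*-zeroʳ c)
  Σfin-*ˡ (suc n) c f = trans (cong (c ℚ.* f zero ℚ.+_) (Σfin-*ˡ n c (f ∘ suc))) (sym (ℚP.*-distribˡ-+ c (f zero) _))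

  Σfin-/ : ∀ n D .{{_ : NonZero D}} (x : Fin n → ℕ) → Σfin n (λ i → + x i / D) ≡ + Σℕfin n x / D
  Σfin-/ zero    D x = sym (ℚP.0/n≡0 D)
  Σfin-/ (suc n) D x = trans (cong (+ x zero / D ℚ.+_) (Σfin-/ n D (x ∘ suc))) (/-+ (x zero) _ D)

  module _ (k : ℕ) where

    ΣLeaves-cong : ∀ d {f g : Leaf k d → ℚ} → (∀ u → f u ≡ g u) → ΣLeaves k d f ≡ ΣLeaves k d g
    ΣLeaves-cong zero    eq = eq []
    ΣLeaves-cong (suc d) eq = Σfin-cong k (λ i → ΣLeaves-cong d (λ u → eq (i ∷ u)))

    ΣLeaves-+ : ∀ d (f g : Leaf k d → ℚ) → ΣLeaves k d (λ u → f u ℚ.+ g u) ≡ ΣLeaves k d f ℚ.+ ΣLeaves k d g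
    ΣLeaves-+ zero    f g = refl
    ΣLeaves-+ (suc d) f g = trans (Σfin-cong k (λ i → ΣLeaves-+ d (λ u → f (i ∷ u)) (λ u → g (i ∷ u)))) (Σfin-+ k _ _)

    ΣLeaves-*ˡ : ∀ d c (f : Leaf k d → ℚ) → ΣLeaves k d (λ u → c ℚ.* f u) ≡ c ℚ.* ΣLeaves k d f
    ΣLeaves-*ˡ zero    c f = refl
    ΣLeaves-*ˡ (suc d) c f = trans (Σfin-cong k (λ i → ΣLeaves-*ˡ d c (λ u → f (i ∷ u)))) (Σfin-*ˡ k c _)

    ΣLeaves-const : ∀ d x D .{{_ : NonZero D}} → ΣLeaves k d (λ _ → + x / D) ≡ + (k ℕ.^ d ℕ.* x) / D
    ΣLeaves-const zero    x D = cong (λ z → + z / D) (sym (ℕP.*-identityˡ x))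
    ΣLeaves-const (suc d) x D = begin
      Σfin k (λ _ → ΣLeaves k d (λ _ → + x / D))  ≡⟨ Σfin-cong k (λ _ → ΣLeaves-const d x D) ⟩
      Σfin k (λ _ → + (k ℕ.^ d ℕ.* x) / D)        ≡⟨ Σfin-/ k D (λ _ → k ℕ.^ d ℕ.* x) ⟩
      + Σℕfin k (λ _ → k ℕ.^ d ℕ.* x) / D          ≡⟨ cong (λ z → + z / D) (trans (Σℕfin-const k _) (sym (ℕP.*-assoc k (k ℕ.^ d) x))) ⟩
      + (k ℕ.^ suc d ℕ.* x) / D                    ∎

  module _ (k : ℕ) .{{_ : NonZero k}} where

    childDev≡ : ∀ m (S : Tree k (suc m)) →
                childDev k (m , S) ≡ (+ deviation k (λ i → reds k m (S i)) / k ℕ.^ suc (suc m)) {{ℕP.m^n≢0 k (suc (suc m))}}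
    childDev≡ m S = begin
      (+ 1 / k) ℚ.* Σfin k (λ i → ℚ.∣ μ k m (S i) ℚ.- μ k (suc m) S ∣)
        ≡⟨ cong ((+ 1 / k) ℚ.*_) (trans (Σfin-cong k child-term) (Σfin-/ k (k ℕ.^ suc m) _)) ⟩
      (+ 1 / k) ℚ.* (+ deviation k f / k ℕ.^ suc m)
        ≡⟨ /-* 1 (deviation k f) k (k ℕ.^ suc m) ⟩
      + (1 ℕ.* deviation k f) / k ℕ.^ suc (suc m)
        ≡⟨ cong (λ z → + z / k ℕ.^ suc (suc m)) (ℕP.*-identityˡ (deviation k f)) ⟩
      + deviation k f / k ℕ.^ suc (suc m) ∎
      where
      instance
        kᵐ≢0 = ℕP.m^n≢0 k m
        kᵐ⁺¹≢0 = ℕP.m^n≢0 k (suc m)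
        kᵐ⁺²≢0 = ℕP.m^n≢0 k (suc (suc m))
      f : Fin k → ℕ
      f i = reds k m (S i)
      child-term : ∀ i → ℚ.∣ μ k m (S i) ℚ.- μ k (suc m) S ∣ ≡ + ℕ.∣ k ℕ.* f i - Σℕfin k f ∣ / k ℕ.^ suc m
      child-term i = trans (cong (λ q → ℚ.∣ q ℚ.- μ k (suc m) S ∣) (/-cross (f i) (k ℕ.* f i) (k ℕ.^ m) (k ℕ.^ suc m) (e₁ (f i) k (k ℕ.^ m))))
                           (∣/-/∣ (k ℕ.* f i) (Σℕfin k f) (k ℕ.^ suc m))
        where
        e₁ : ∀ x k K → x ℕ.* (k ℕ.* K) ≡ k ℕ.* x ℕ.* K
        e₁ = solve-∀

    pathSum≡ : ∀ d (T : Tree k d) →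
               ΣLeaves k d (λ u → Σfin d (λ t → childDev k (nodeOnPath k d T u t))) ≡ + totalDeviation k d T / k
    pathSum≡ zero    T = sym (ℚP.0/n≡0 k)
    pathSum≡ (suc d) T = begin
      Σfin k (λ i → ΣLeaves k d (λ u → c ℚ.+ H i u))
        ≡⟨ Σfin-cong k (λ i → ΣLeaves-+ k d (λ _ → c) (H i)) ⟩
      Σfin k (λ i → ΣLeaves k d (λ _ → c) ℚ.+ ΣLeaves k d (H i))
        ≡⟨ Σfin-+ k _ _ ⟩
      Σfin k (λ _ → ΣLeaves k d (λ _ → c)) ℚ.+ Σfin k (λ i → ΣLeaves k d (H i))
        ≡⟨ cong₂ ℚ._+_ (Σfin-cong k (λ _ → trans (ΣLeaves-cong k d (λ _ → childDev≡ d T)) (ΣLeaves-const k d A₀ (k ℕ.^ suc (suc d)))))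
                       (Σfin-cong k (λ i → pathSum≡ d (T i))) ⟩
      Σfin k (λ _ → + (k ℕ.^ d ℕ.* A₀) / k ℕ.^ suc (suc d)) ℚ.+ Σfin k (λ i → + totalDeviation k d (T i) / k)
        ≡⟨ cong₂ ℚ._+_ (Σfin-/ k (k ℕ.^ suc (suc d)) _) (Σfin-/ k k _) ⟩
      + Σℕfin k (λ _ → k ℕ.^ d ℕ.* A₀) / k ℕ.^ suc (suc d) ℚ.+ + ΣA / k
        ≡⟨ cong (ℚ._+ + ΣA / k) (/-cross (Σℕfin k (λ _ → k ℕ.^ d ℕ.* A₀)) A₀ (k ℕ.^ suc (suc d)) k
             (trans (cong (ℕ._* k) (Σℕfin-const k (k ℕ.^ d ℕ.* A₀))) (e₁ k (k ℕ.^ d) A₀))) ⟩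
      + A₀ / k ℚ.+ + ΣA / k
        ≡⟨ /-+ A₀ ΣA k ⟩
      + totalDeviation k (suc d) T / k ∎
      where
      instance
        kᵈ⁺²≢0 = ℕP.m^n≢0 k (suc (suc d))
      c = childDev k (d , T)
      H : Fin k → Leaf k d → ℚ
      H i u = Σfin d (λ t → childDev k (nodeOnPath k d (T i) u t))
      A₀ = deviation k (λ i → reds k d (T i))
      ΣA = Σℕfin k (λ i → totalDeviation k d (T i))
      e₁ : ∀ k K A → k ℕ.* (K ℕ.* A) ℕ.* k ≡ A ℕ.* (k ℕ.* (k ℕ.* K))
      e₁ = solve-∀

    kᵈdk≢0 : ∀ d .{{_ : NonZero d}} → NonZero (k ℕ.^ d ℕ.* (d ℕ.* k))
    kᵈdk≢0 d = ℕP.m*n≢0 (k ℕ.^ d) (d ℕ.* k) {{ℕP.m^n≢0 k d}} {{ℕP.m*n≢0 d k}}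

    expectation≡ : ∀ d .{{_ : NonZero d}} (T : Tree k d) →
      expectation k d T ≡ (+ totalDeviation k d T / (k ℕ.^ d ℕ.* (d ℕ.* k))) {{kᵈdk≢0 d}}
    expectation≡ d T = begin
      (+ 1 / k ℕ.^ d) ℚ.* ΣLeaves k d (λ u → (+ 1 / d) ℚ.* Σfin d (λ t → childDev k (nodeOnPath k d T u t)))
        ≡⟨ cong ((+ 1 / k ℕ.^ d) ℚ.*_) (trans (ΣLeaves-*ˡ k d (+ 1 / d) _) (cong ((+ 1 / d) ℚ.*_) (pathSum≡ d T))) ⟩
      (+ 1 / k ℕ.^ d) ℚ.* ((+ 1 / d) ℚ.* (+ A / k))
        ≡⟨ cong ((+ 1 / k ℕ.^ d) ℚ.*_) (/-* 1 A d k) ⟩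
      (+ 1 / k ℕ.^ d) ℚ.* (+ (1 ℕ.* A) / (d ℕ.* k))
        ≡⟨ /-* 1 (1 ℕ.* A) (k ℕ.^ d) (d ℕ.* k) ⟩
      + (1 ℕ.* (1 ℕ.* A)) / (k ℕ.^ d ℕ.* (d ℕ.* k))
        ≡⟨ cong (λ z → + z / (k ℕ.^ d ℕ.* (d ℕ.* k))) (trans (ℕP.*-identityˡ (1 ℕ.* A)) (ℕP.*-identityˡ A)) ⟩
      + A / (k ℕ.^ d ℕ.* (d ℕ.* k)) ∎
      where
      instance
        kᵈ≢0 = ℕP.m^n≢0 k d
        dk≢0 = ℕP.m*n≢0 d k
        kᵈdk≢0′ = kᵈdk≢0 d
      A = totalDeviation k d T

open import Defs
open import Data.Nat as ℕ using (ℕ; NonZero; _≤_)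
open import Data.Integer using (+_)
open import Data.Rational as ℚ using (ℚ; 0ℚ; 1ℚ; _*_; _/_)
open import Relation.Binary.PropositionalEquality using (_≡_; _≢_)
open import Data.Product using (_×_)

import Data.Nat.Properties as ℕP
import Data.Rational.Properties as ℚP
open import Data.Nat.Tactic.RingSolver using (solve-∀)
open import Data.Product using (_,_)
open import Relation.Binary.PropositionalEquality using (sym; trans; cong; cong₂; subst₂; module ≡-Reasoning)
open NatFractions
open ExpectationFormula using (expectation≡; kᵈdk≢0)
open PinskerChain using (totalDeviation; totalDeviation≡0; 2^a*r^b≤k^[d*b])

module _ (k : ℕ) .{{_ : NonZero k}} (d : ℕ) .{{_ : NonZero d}} (T : Tree k d) where

  private
    r = reds k d T
    A = totalDeviation k d T
    K = k ℕ.^ d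
    instance
      K≢0 = ℕP.m^n≢0 k d
      Kdk≢0 = kᵈdk≢0 k d

  μ≡0⇒reds≡0 : μ k d T ≡ 0ℚ → r ≡ 0
  μ≡0⇒reds≡0 μ≡0 = trans (sym (ℕP.*-identityʳ r)) (/-cross⁻¹ r 0 K 1 (trans μ≡0 (sym (ℚP.0/n≡0 1))))

  μ≢0⇒reds≢0 : μ k d T ≢ 0ℚ → NonZero r
  μ≢0⇒reds≢0 μ≢0 = ℕ.≢-nonZero (λ r≡0 → μ≢0 (trans (cong (λ x → + x / K) r≡0) (ℚP.0/n≡0 K)))

  μ≡0⇒expectation≡0 : μ k d T ≡ 0ℚ → expectation k d T ≡ 0ℚ
  μ≡0⇒expectation≡0 μ≡0 = trans (expectation≡ k d T)
    (trans (cong (λ x → + x / (K ℕ.* (d ℕ.* k))) (totalDeviation≡0 k d T (μ≡0⇒reds≡0 μ≡0)))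
           (ℚP.0/n≡0 (K ℕ.* (d ℕ.* k))))

  ratio⇒A²b≡2ar²dk² : ∀ a b .{{_ : NonZero b}} →
    (+ d / 1) * (expectation k d T * expectation k d T) ≡ ((+ a) / b) * ((+ 2 / 1) * (μ k d T * μ k d T)) →
    A ℕ.* A ℕ.* b ≡ 2 ℕ.* a ℕ.* (r ℕ.* r) ℕ.* d ℕ.* (k ℕ.* k)
  ratio⇒A²b≡2ar²dk² a b eq = ℕP.*-cancelˡ-≡ _ _ (d ℕ.* (K ℕ.* K)) (begin
    d ℕ.* (K ℕ.* K) ℕ.* (A ℕ.* A ℕ.* b)                ≡⟨ e₁ d A b K ⟩
    d ℕ.* (A ℕ.* A) ℕ.* (b ℕ.* (1 ℕ.* (K ℕ.* K)))      ≡⟨ /-cross⁻¹ (d ℕ.* (A ℕ.* A)) (a ℕ.* (2 ℕ.* (r ℕ.* r)))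
                                                              (1 ℕ.* (D ℕ.* D)) (b ℕ.* (1 ℕ.* (K ℕ.* K))) cross ⟩
    a ℕ.* (2 ℕ.* (r ℕ.* r)) ℕ.* (1 ℕ.* (D ℕ.* D))      ≡⟨ e₂ a r K d k ⟩
    d ℕ.* (K ℕ.* K) ℕ.* (2 ℕ.* a ℕ.* (r ℕ.* r) ℕ.* d ℕ.* (k ℕ.* k)) ∎)
    where
    open ≡-Reasoning
    D = K ℕ.* (d ℕ.* k)
    instance
      KK≢0 = ℕP.m*n≢0 K K
      1KK≢0 = ℕP.m*n≢0 1 (K ℕ.* K)
      b1KK≢0 = ℕP.m*n≢0 b (1 ℕ.* (K ℕ.* K))
      DD≢0 = ℕP.m*n≢0 D D
      1DD≢0 = ℕP.m*n≢0 1 (D ℕ.* D)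
      dKK≢0 = ℕP.m*n≢0 d (K ℕ.* K)
    cross : + (d ℕ.* (A ℕ.* A)) / (1 ℕ.* (D ℕ.* D)) ≡ + (a ℕ.* (2 ℕ.* (r ℕ.* r))) / (b ℕ.* (1 ℕ.* (K ℕ.* K)))
    cross = begin
      + (d ℕ.* (A ℕ.* A)) / (1 ℕ.* (D ℕ.* D))            ≡⟨ /-* d (A ℕ.* A) 1 (D ℕ.* D) ⟨
      (+ d / 1) * (+ (A ℕ.* A) / (D ℕ.* D))              ≡⟨ cong ((+ d / 1) *_) (/-* A A D D) ⟨
      (+ d / 1) * ((+ A / D) * (+ A / D))                ≡⟨ cong (λ x → (+ d / 1) * (x * x)) (expectation≡ k d T) ⟨
      (+ d / 1) * (expectation k d T * expectation k d T) ≡⟨ eq ⟩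
      (+ a / b) * ((+ 2 / 1) * ((+ r / K) * (+ r / K)))  ≡⟨ cong (λ x → (+ a / b) * ((+ 2 / 1) * x)) (/-* r r K K) ⟩
      (+ a / b) * ((+ 2 / 1) * (+ (r ℕ.* r) / (K ℕ.* K))) ≡⟨ cong ((+ a / b) *_) (/-* 2 (r ℕ.* r) 1 (K ℕ.* K)) ⟩
      (+ a / b) * (+ (2 ℕ.* (r ℕ.* r)) / (1 ℕ.* (K ℕ.* K))) ≡⟨ /-* a (2 ℕ.* (r ℕ.* r)) b (1 ℕ.* (K ℕ.* K)) ⟩
      + (a ℕ.* (2 ℕ.* (r ℕ.* r))) / (b ℕ.* (1 ℕ.* (K ℕ.* K))) ∎
    e₁ : ∀ d A b K → d ℕ.* (K ℕ.* K) ℕ.* (A ℕ.* A ℕ.* b) ≡ d ℕ.* (A ℕ.* A) ℕ.* (b ℕ.* (1 ℕ.* (K ℕ.* K)))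
    e₁ = solve-∀
    e₂ : ∀ a r K d k → a ℕ.* (2 ℕ.* (r ℕ.* r)) ℕ.* (1 ℕ.* (K ℕ.* (d ℕ.* k) ℕ.* (K ℕ.* (d ℕ.* k))))
                      ≡ d ℕ.* (K ℕ.* K) ℕ.* (2 ℕ.* a ℕ.* (r ℕ.* r) ℕ.* d ℕ.* (k ℕ.* k))
    e₂ = solve-∀

  2^a*μ^b≤1 : ∀ a b → 2 ℕ.^ a ℕ.* r ℕ.^ b ≤ k ℕ.^ (d ℕ.* b) → ((+ 2 / 1) ^ℚ a) * (μ k d T ^ℚ b) ℚ.≤ 1ℚ
  2^a*μ^b≤1 a b le = begin
    ((+ 2 / 1) ^ℚ a) * ((+ r / K) ^ℚ b)                   ≡⟨ cong₂ _*_ (/-^ 2 1 a) (/-^ r K b) ⟩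
    (+ (2 ℕ.^ a) / (1 ℕ.^ a)) * (+ (r ℕ.^ b) / (K ℕ.^ b)) ≡⟨ /-* (2 ℕ.^ a) (r ℕ.^ b) (1 ℕ.^ a) (K ℕ.^ b) ⟩
    + (2 ℕ.^ a ℕ.* r ℕ.^ b) / (1 ℕ.^ a ℕ.* K ℕ.^ b)       ≤⟨ /-≤ (2 ℕ.^ a ℕ.* r ℕ.^ b) 1 (1 ℕ.^ a ℕ.* K ℕ.^ b) 1 cross ⟩
    1ℚ                                                     ∎
    where
    open ℚP.≤-Reasoning
    instance
      1ᵃ≢0 = ℕP.m^n≢0 1 a
      Kᵇ≢0 = ℕP.m^n≢0 K b
      1ᵃKᵇ≢0 = ℕP.m*n≢0 (1 ℕ.^ a) (K ℕ.^ b)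
    cross : 2 ℕ.^ a ℕ.* r ℕ.^ b ℕ.* 1 ≤ 1 ℕ.* (1 ℕ.^ a ℕ.* K ℕ.^ b)
    cross = subst₂ _≤_ (sym (ℕP.*-identityʳ (2 ℕ.^ a ℕ.* r ℕ.^ b)))
      (sym (trans (ℕP.*-identityˡ (1 ℕ.^ a ℕ.* K ℕ.^ b)) (trans (cong (ℕ._* K ℕ.^ b) (ℕP.^-zeroˡ a))
                  (trans (ℕP.*-identityˡ (K ℕ.^ b)) (ℕP.^-*-assoc k d b))))) le

-- For μ > 0 the bound reads d E² / (2 μ²) ≤ log₂ (1 / μ), stated for every representation
-- a / b of the left-hand side as 2^a μ^b ≤ 1.
lemma13 : (k : ℕ) .{{_ : NonZero k}} → 2 ≤ k → (d : ℕ) .{{_ : NonZero d}} → (T : Tree k d)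
          → (μ k d T ≡ 0ℚ → expectation k d T ℚ.≤ 0ℚ)
            × (μ k d T ≢ 0ℚ → (a b : ℕ) .{{_ : NonZero b}}
                → (+ d / 1) * (expectation k d T * expectation k d T) ≡ ((+ a) / b) * ((+ 2 / 1) * (μ k d T * μ k d T))
                → ((+ 2 / 1) ^ℚ a) * (μ k d T ^ℚ b) ℚ.≤ 1ℚ)
lemma13 k _ d T =
    (λ μ≡0 → ℚP.≤-reflexive (μ≡0⇒expectation≡0 k d T μ≡0))
  , (λ μ≢0 a b ratio → 2^a*μ^b≤1 k d T a b
       (2^a*r^b≤k^[d*b] k d T {{μ≢0⇒reds≢0 k d T μ≢0}} a b (ratio⇒A²b≡2ar²dk² k d T a b ratio)))
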